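{- For each $n\ge1$, the Tutte polynomial of the graph $\Gamma_n^\ast$ is $$T(\Gamma_n^\ast;x,y)=x^{2^{n-1}}(y+x)^{2^{n-1}-1}.$$
   Context: Let $X^n$ denote the set of binary words of length $n$ over $\{0,1\}$. The Grigorchuk group is generated by the automorphisms $a,b,c,d$ of the rooted binary tree defined recursively on finite binary words $w$ by $a(0w)=1w$, $a(1w)=0w$, $b(0w)=0a(w)$, $b(1w)=1c(w)$, $c(0w)=0a(w)$, $c(1w)=1d(w)$, $d(0w)=0w$, $d(1w)=1b(w)$; each generator is an involution. For $n\geq1$, the Schreier graph $\Gamma_n$ is the finite multigraph with vertex set $X^n$ having, for each $s\in\{a,b,c,d\}$ and each orbit $\{u,s(u)\}$ of $s$ on $X^n$, one edge joining $u$ and $s(u)$ (a loop when $s(u)=u$). $\Gamma_n^\ast$ is obtained from $\Gamma_n$ by deleting all loops. For a finite multigraph $G=(V,E)$, $T(G;x,y)=\sum_{A\subseteq E}(x-1)^{r(E)-r(A)}(y-1)^{|A|-r(A)}$ with $r(A)=|V|-k(A)$, $k(A)$ the number of connected components of $(V,A)$. -}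

module Defs where

open import Level using (Level)
open import Data.Bool using (Bool; true; false; not; _∧_; _∨_; if_then_else_)
open import Data.Nat using (ℕ; zero; suc; _∸_)
open import Data.List using (List; []; _∷_; length; map; filter; concatMap; foldr; _++_)
open import Data.Bool.ListAction using (any)
open import Algebra.Bundles using (Semiring)
open import Data.Vec using (Vec; []; _∷_)
open import Data.Vec.Properties using (≡-dec)
open import Data.Product using (_×_; _,_; proj₁; proj₂)
open import Relation.Binary.Definitions using (DecidableEquality)
open import Relation.Nullary using (¬?)
open import Relation.Nullary.Decidable using (⌊_⌋)
open import Algebra.Bundles using (CommutativeRing)
import Algebra.Definitions.RawSemiring as RS
import Data.Bool.Properties as BoolP

-- Finite multigraphs: a list of (distinct) vertices and a list of edges
-- (each edge = ordered pair of endpoints; list positions distinguish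
-- parallel edges; an edge (u , u) is a loop).

pow : ∀ {c ℓ} (R : CommutativeRing c ℓ) →
      CommutativeRing.Carrier R → ℕ → CommutativeRing.Carrier R
pow R = RS._^_ (Semiring.rawSemiring (CommutativeRing.semiring R))

record MultiGraph (V : Set) : Set where
  constructor mkGraph
  field
    vertices : List V
    edges    : List (V × V)

open MultiGraph public

module GraphTheory {V : Set} (_≟_ : DecidableEquality V) where

  eqb : V → V → Bool
  eqb u v = ⌊ u ≟ v ⌋

  step : List (V × V) → (V → Bool) → (V → Bool)
  step A S w = S w ∨ any (λ e → (S (proj₁ e) ∧ eqb (proj₂ e) w)
                              ∨ (S (proj₂ e) ∧ eqb (proj₁ e) w)) A

  iter : {X : Set} → ℕ → (X → X) → X → X
  iter zero    f a = a
  iter (suc k) f a = f (iter k f a)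

  -- connected vs w : w is reachable from v in (vs , A); walks in a graph
  -- with |vs| vertices need at most |vs| steps.
  connected : List V → List (V × V) → V → V → Bool
  connected vs A v = iter (length vs) (step A) (eqb v)

  -- number of connected components of the spanning subgraph (vs , A):
  -- count the vertices not connected to any earlier vertex of the list
  componentsAux : List V → List (V × V) → List V → List V → ℕ
  componentsAux vs A earlier []       = zero
  componentsAux vs A earlier (v ∷ rest) =
    (if any (λ u → connected vs A u v) earlier then 0 else 1)
    Data.Nat.+ componentsAux vs A (v ∷ earlier) rest

  components : List V → List (V × V) → ℕ
  components vs A = componentsAux vs A [] vs

  rank : List V → List (V × V) → ℕ
  rank vs A = length vs ∸ components vs A

  sublists : {A : Set} → List A → List (List A)
  sublists []       = [] ∷ []
  sublists (e ∷ es) = let s = sublists es in s ++ map (e ∷_) s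

  deleteLoops : MultiGraph V → MultiGraph V
  deleteLoops G = mkGraph (vertices G)
    (filter (λ e → ¬? (proj₁ e ≟ proj₂ e)) (edges G))

  -- the Tutte polynomial T(G; x, y) evaluated in a commutative ring R
  -- (the polynomial identity in ℤ[x,y] is equivalent to the identity
  -- holding for all x, y in all commutative rings)
  tutte : ∀ {c ℓ} (R : CommutativeRing c ℓ) → MultiGraph V →
          CommutativeRing.Carrier R → CommutativeRing.Carrier R →
          CommutativeRing.Carrier R
  tutte R G x y =
    foldr (λ A acc → ((x - 1#) ^ (rank vs E ∸ rank vs A))
                   * ((y - 1#) ^ (length A ∸ rank vs A)) + acc)
          0# (sublists E)
    where
      open CommutativeRing R
      _^_ = pow R
      vs = vertices G
      E  = edges G

-- The Grigorchuk group generators acting on binary words of length n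
-- (0 = false, 1 = true)

Word : ℕ → Set
Word n = Vec Bool n

mutual
  actA : ∀ {n} → Word n → Word n
  actA []      = []
  actA (x ∷ w) = not x ∷ w

  actB : ∀ {n} → Word n → Word n
  actB []          = []
  actB (false ∷ w) = false ∷ actA w
  actB (true ∷ w)  = true ∷ actC w

  actC : ∀ {n} → Word n → Word n
  actC []          = []
  actC (false ∷ w) = false ∷ actA w
  actC (true ∷ w)  = true ∷ actD w

  actD : ∀ {n} → Word n → Word n
  actD []          = []
  actD (false ∷ w) = false ∷ w
  actD (true ∷ w)  = true ∷ actB w

data Gen : Set where
  a b c d : Gen

act : Gen → ∀ {n} → Word n → Word n
act a = actA
act b = actB
act c = actC
act d = actD

generators : List Gen
generators = a ∷ b ∷ c ∷ d ∷ []

allWords : (n : ℕ) → List (Word n)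
allWords zero    = [] ∷ []
allWords (suc n) = map (false ∷_) (allWords n) ++ map (true ∷_) (allWords n)

-- strict lexicographic order (false < true), used only to pick one
-- representative pair per 2-element orbit
lexLess : ∀ {n} → Word n → Word n → Bool
lexLess []          []          = false
lexLess (false ∷ u) (false ∷ v) = lexLess u v
lexLess (true ∷ u)  (true ∷ v)  = lexLess u v
lexLess (false ∷ u) (true ∷ v)  = true
lexLess (true ∷ u)  (false ∷ v) = false

_≟W_ : ∀ {n} → DecidableEquality (Word n)
_≟W_ = ≡-dec BoolP._≟_

-- Edges of Γ_n: for each generator s and each orbit {u , s u} of s on X^n,
-- one edge: a loop (u , u) if s u = u, else (u , s u) with u the lex-smaller.
orbitEdges : ∀ n → Gen → List (Word n × Word n)
orbitEdges n s = concatMap edgeAt (allWords n)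
  where
    edgeAt : Word n → List (Word n × Word n)
    edgeAt u = if ⌊ act s u ≟W u ⌋ then (u , u) ∷ []
               else (if lexLess u (act s u) then (u , act s u) ∷ [] else [])

Γ : (n : ℕ) → MultiGraph (Word n)
Γ n = mkGraph (allWords n) (concatMap (orbitEdges n) generators)

Γ* : (n : ℕ) → MultiGraph (Word n)
Γ* n = GraphTheory.deleteLoops _≟W_ (Γ n)

TutteW : ∀ {c ℓ} (R : CommutativeRing c ℓ) (n : ℕ) → MultiGraph (Word n) →
         CommutativeRing.Carrier R → CommutativeRing.Carrier R →
         CommutativeRing.Carrier R
TutteW R n = GraphTheory.tutte (_≟W_ {n}) R

-- Number the words of length n by a reflected binary code pos. Every generator moves a word by at
-- most one position: a across the gaps p → p + 1 with p even, and b, c, d across the odd gaps, where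
-- exactly two of them move the word. So Γ_n^* is a path on 2^n vertices whose 2^n - 1 gaps carry
-- alternately one and two parallel edges.
-- For a spanning subgraph A of such a path the components are intervals, so r(A) is the number of
-- gaps that A covers. Splitting the subsets of E by their edges at each gap, the sum defining T
-- factorises over the gaps, a gap with k parallel edges contributing x + y + ⋯ + y^(k-1). With
-- 2^(n-1) single and 2^(n-1) - 1 double gaps, T = x^(2^(n-1)) (x + y)^(2^(n-1) - 1).

module Submission where

open import Defs
open import Data.Nat using (ℕ; _≥_; _∸_; _^_)
open import Algebra.Bundles using (CommutativeRing)

open import Data.Nat
  using (zero; suc; _+_; _*_; _≤_; _<_; z≤n; s≤s; z<s; _⊓_; _≡ᵇ_; ⌊_/2⌋; _≤′_; ≤′-refl; ≤′-step)
open import Data.Nat.Properties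
open import Algebra.Properties.CommutativeSemigroup +-commutativeSemigroup using (interchange)
open import Data.Bool using (Bool; true; false; not; _∧_; _∨_; _xor_; if_then_else_; T)
open import Data.Bool.Properties
  using ( ∨-assoc; ∨-comm; ∧-identityʳ; not-involutive; not-injective; not-¬
        ; xor-assoc; xor-same; xor-identityʳ; T-≡; T-∨; T-∧; ⇔→≡ )
open import Data.Bool.ListAction using (any; or)
open import Data.Vec using ([]; _∷_)
open import Data.Vec.Properties using (∷-injectiveˡ; ∷-injectiveʳ)
open import Data.List using (List; []; _∷_; length; map; _++_; foldr; filter; concatMap)
open import Data.List.Properties
  using (filter-++; filter-accept; ++-identityʳ; length-++; length-++-sucʳ; length-map; map-cong)
open import Data.List.Membership.Propositional using (_∈_; find; lose)
open import Data.List.Membership.Propositional.Properties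
  using (∈-++⁺ˡ; ∈-++⁺ʳ; ∈-++⁻; ∈-map⁺; ∈-map⁻; ∈-filter⁻; ∈-concatMap⁻)
open import Data.List.Relation.Unary.Any using (Any; here; there)
open import Data.List.Relation.Unary.Any.Properties using (any⁺; any⁻)
open import Data.List.Relation.Unary.All as All using (All; []; _∷_)
open import Data.Product using (Σ; _×_; _,_; proj₁; proj₂)
open import Data.Sum using (_⊎_; inj₁; inj₂; swap; [_,_]′)
import Data.Sum as Sum
open import Data.Empty using (⊥-elim)
open import Function using (Equivalence; mk⇔; _∘_; id)
open import Relation.Binary.Definitions using (DecidableEquality)
open import Relation.Binary.PropositionalEquality
open import Relation.Unary using (Decidable)
open import Relation.Nullary using (¬_; ¬?; yes; no)
open import Relation.Nullary.Decidable
  using (⌊_⌋; toWitness; fromWitness; isYes≗does; dec-true; dec-false; does-⇔)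
open import Relation.Nullary.Negation using (contradiction)
open Equivalence using (to; from)

bit : Bool → ℕ
bit false = 0
bit true  = 1

bit≤1 : ∀ b → bit b ≤ 1
bit≤1 false = z≤n
bit≤1 true  = s≤s z≤n

bit-not+bit≡1 : ∀ b → bit (not b) + bit b ≡ 1
bit-not+bit≡1 false = refl
bit-not+bit≡1 true  = refl

bit-∨∧not : ∀ u r e → bit ((u ∨ r) ∧ not e) ≡ bit (u ∧ not e) + bit (r ∧ not (u ∨ e))
bit-∨∧not true  true  true  = refl
bit-∨∧not true  false true  = refl
bit-∨∧not true  true  false = refl
bit-∨∧not true  false false = refl
bit-∨∧not false r     e     = refl

bit-∨ : ∀ u v → bit (u ∨ v) ≡ bit v + bit (u ∧ not v)
bit-∨ true  true  = refl
bit-∨ true  false = refl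
bit-∨ false v     = sym (+-identityʳ (bit v))

≡ᵇ-true⇒≡ : ∀ {m k} → (m ≡ᵇ k) ≡ true → m ≡ k
≡ᵇ-true⇒≡ {m} {k} eq = ≡ᵇ⇒≡ m k (from T-≡ eq)

≡⇒≡ᵇ-true : ∀ {m k} → m ≡ k → (m ≡ᵇ k) ≡ true
≡⇒≡ᵇ-true {m} {k} eq = to T-≡ (≡⇒≡ᵇ m k eq)

≢⇒≡ᵇ-false : ∀ {m k} → ¬ m ≡ k → (m ≡ᵇ k) ≡ false
≢⇒≡ᵇ-false {m} {k} m≢k with m ≡ᵇ k in eq
... | true  = ⊥-elim (m≢k (≡ᵇ-true⇒≡ eq))
... | false = refl

sumBelow : ℕ → (ℕ → ℕ) → ℕ
sumBelow zero    f = 0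
sumBelow (suc m) f = sumBelow m f + f m

sumBelow-cong : ∀ m {f g : ℕ → ℕ} → (∀ k → k < m → f k ≡ g k) → sumBelow m f ≡ sumBelow m g
sumBelow-cong zero    eq = refl
sumBelow-cong (suc m) eq =
  cong₂ _+_ (sumBelow-cong m (λ k k<m → eq k (m<n⇒m<1+n k<m))) (eq m (n<1+n m))

sumBelow-zero : ∀ m {f : ℕ → ℕ} → (∀ k → k < m → f k ≡ 0) → sumBelow m f ≡ 0
sumBelow-zero zero    eq = refl
sumBelow-zero (suc m) eq =
  cong₂ _+_ (sumBelow-zero m (λ k k<m → eq k (m<n⇒m<1+n k<m))) (eq m (n<1+n m))

sumBelow-+ : ∀ m (f g : ℕ → ℕ) → sumBelow m (λ k → f k + g k) ≡ sumBelow m f + sumBelow m g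
sumBelow-+ zero    f g = refl
sumBelow-+ (suc m) f g =
  trans (cong (_+ (f m + g m)) (sumBelow-+ m f g))
        (interchange (sumBelow m f) (sumBelow m g) (f m) (g m))

sumBelow-1 : ∀ m → sumBelow m (λ _ → 1) ≡ m
sumBelow-1 zero    = refl
sumBelow-1 (suc m) = trans (cong (_+ 1) (sumBelow-1 m)) (+-comm m 1)

sumBelow-suc : ∀ m (f : ℕ → ℕ) → sumBelow (suc m) f ≡ f 0 + sumBelow m (λ k → f (suc k))
sumBelow-suc zero    f = +-comm 0 (f 0)
sumBelow-suc (suc m) f =
  trans (cong (_+ f (suc m)) (sumBelow-suc m f)) (+-assoc (f 0) _ (f (suc m)))

sumBelow-bit≤ : ∀ m (t : ℕ → Bool) → sumBelow m (λ k → bit (t k)) ≤ m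
sumBelow-bit≤ zero    t = z≤n
sumBelow-bit≤ (suc m) t =
  subst (sumBelow (suc m) (λ k → bit (t k)) ≤_) (+-comm m 1)
        (+-mono-≤ (sumBelow-bit≤ m t) (bit≤1 (t m)))

sumBelow-not+sumBelow : ∀ m (t : ℕ → Bool) →
  sumBelow m (λ k → bit (not (t k))) + sumBelow m (λ k → bit (t k)) ≡ m
sumBelow-not+sumBelow m t =
  trans (sym (sumBelow-+ m _ _))
        (trans (sumBelow-cong m (λ k _ → bit-not+bit≡1 (t k))) (sumBelow-1 m))

sumBelow-indicator : ∀ m {i} (f : ℕ → Bool) → i < m →
  sumBelow m (λ k → bit ((i ≡ᵇ k) ∧ f k)) ≡ bit (f i)
sumBelow-indicator (suc m) {i} f i<1+m with i ≟ m
... | yes refl =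
  cong₂ _+_ (sumBelow-zero i (λ k k<i → cong (λ β → bit (β ∧ f k)) (≢⇒≡ᵇ-false (>⇒≢ k<i))))
            (cong (λ β → bit (β ∧ f i)) (≡⇒≡ᵇ-true {i} refl))
... | no i≢m =
  trans (cong₂ _+_ (sumBelow-indicator m f (≤∧≢⇒< (≤-pred i<1+m) i≢m))
                   (cong (λ β → bit (β ∧ f m)) (≢⇒≡ᵇ-false i≢m)))
        (+-identityʳ _)

sumList : {X : Set} → (X → ℕ) → List X → ℕ
sumList f []       = 0
sumList f (x ∷ xs) = f x + sumList f xs

sumList-++ : ∀ {X : Set} (f : X → ℕ) xs ys → sumList f (xs ++ ys) ≡ sumList f xs + sumList f ys
sumList-++ f []       ys = refl
sumList-++ f (x ∷ xs) ys = trans (cong (f x +_) (sumList-++ f xs ys)) (sym (+-assoc (f x) _ _))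

sumList-map : ∀ {X Y : Set} (f : Y → ℕ) (h : X → Y) xs →
              sumList f (map h xs) ≡ sumList (λ x → f (h x)) xs
sumList-map f h []       = refl
sumList-map f h (x ∷ xs) = cong (f (h x) +_) (sumList-map f h xs)

sumList-cong : ∀ {X : Set} {f g : X → ℕ} xs → (∀ x → f x ≡ g x) → sumList f xs ≡ sumList g xs
sumList-cong []       eq = refl
sumList-cong (x ∷ xs) eq = cong₂ _+_ (eq x) (sumList-cong xs eq)

sumList-+ : ∀ {X : Set} (f g : X → ℕ) xs → sumList (λ x → f x + g x) xs ≡ sumList f xs + sumList g xs
sumList-+ f g []       = refl
sumList-+ f g (x ∷ xs) =
  trans (cong (f x + g x +_) (sumList-+ f g xs)) (interchange (f x) (g x) (sumList f xs) (sumList g xs))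

sumList-zero : ∀ {X : Set} (xs : List X) → sumList (λ _ → 0) xs ≡ 0
sumList-zero []       = refl
sumList-zero (x ∷ xs) = sumList-zero xs

sumList-filter-concatMap : ∀ {X Y : Set} {P : Y → Set} (P? : Decidable P) (f : Y → ℕ)
  (h : X → List Y) xs → sumList f (filter P? (concatMap h xs)) ≡ sumList (λ x → sumList f (filter P? (h x))) xs
sumList-filter-concatMap P? f h []       = refl
sumList-filter-concatMap P? f h (x ∷ xs) =
  trans (cong (sumList f) (filter-++ P? (h x) (concatMap h xs)))
        (trans (sumList-++ f (filter P? (h x)) _)
               (cong (sumList f (filter P? (h x)) +_) (sumList-filter-concatMap P? f h xs)))

isEven : ℕ → Bool
isEven zero    = true
isEven (suc n) = not (isEven n)

double : ℕ → ℕ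
double zero    = zero
double (suc n) = suc (suc (double n))

double≡2* : ∀ m → double m ≡ 2 * m
double≡2* zero    = refl
double≡2* (suc m) = cong suc (trans (cong suc (double≡2* m)) (sym (+-suc m (m + 0))))

isEven-double : ∀ q → isEven (double q) ≡ true
isEven-double zero    = refl
isEven-double (suc q) = cong (λ β → not (not β)) (isEven-double q)

isEven-bit+double : ∀ t q → isEven (bit t + double q) ≡ not t
isEven-bit+double false q = isEven-double q
isEven-bit+double true  q = cong not (isEven-double q)

⌊bit+double/2⌋ : ∀ t q → ⌊ bit t + double q /2⌋ ≡ q
⌊bit+double/2⌋ false zero    = refl
⌊bit+double/2⌋ false (suc q) = cong suc (⌊bit+double/2⌋ false q)
⌊bit+double/2⌋ true  zero    = refl
⌊bit+double/2⌋ true  (suc q) = cong suc (⌊bit+double/2⌋ true q)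

bit+double-injective : ∀ {t t′ q q′} → bit t + double q ≡ bit t′ + double q′ → t ≡ t′ × q ≡ q′
bit+double-injective {t} {t′} {q} {q′} eq =
  not-injective (trans (sym (isEven-bit+double t q))
                       (trans (cong isEven eq) (isEven-bit+double t′ q′))) ,
  trans (sym (⌊bit+double/2⌋ t q)) (trans (cong ⌊_/2⌋ eq) (⌊bit+double/2⌋ t′ q′))

bit+double-surjective : ∀ k → Σ Bool λ t → Σ ℕ λ q → bit t + double q ≡ k
bit+double-surjective zero          = false , zero , refl
bit+double-surjective (suc zero)    = true , zero , refl
bit+double-surjective (suc (suc k)) with bit+double-surjective k
... | t , q , eq =
  t , suc q , trans (+-suc (bit t) (suc (double q))) (cong suc (trans (+-suc (bit t) (double q)) (cong suc eq)))

double-mono-≤ : ∀ {m k} → m ≤ k → double m ≤ double k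
double-mono-≤ z≤n       = z≤n
double-mono-≤ (s≤s m≤k) = s≤s (s≤s (double-mono-≤ m≤k))

double-cancel-< : ∀ m k → double m < double k → m < k
double-cancel-< zero    (suc k) _                 = s≤s z≤n
double-cancel-< (suc m) (suc k) (s≤s (s≤s lt)) = s≤s (double-cancel-< m k lt)

bit+double<double : ∀ t {q m} → q < m → bit t + double q < double m
bit+double<double t {q} q<m = ≤-trans (s≤s (+-monoˡ-≤ (double q) (bit≤1 t))) (double-mono-≤ q<m)

bit+double<double⁻ : ∀ t q m → bit t + double q < double m → q < m
bit+double<double⁻ t q m lt = double-cancel-< q m (≤-trans (s≤s (m≤n+m (double q) (bit t))) lt)

-- The subset expansion of the Tutte polynomial over gaps

module GapCount {Edge : Set} (gap : Edge → ℕ) (M : ℕ) where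

  covers : List Edge → ℕ → Bool
  covers A p = any (λ e → gap e ≡ᵇ p) A

  coveredGaps : List Edge → ℕ
  coveredGaps A = sumBelow M (λ p → bit (covers A p))

  mult : List Edge → ℕ → ℕ
  mult E p = sumList (λ e → bit (gap e ≡ᵇ p)) E

  coveredGaps-all : ∀ {A} → (∀ p → p < M → T (covers A p)) → coveredGaps A ≡ M
  coveredGaps-all all =
    trans (sumBelow-cong M (λ p p<M → cong bit (to T-≡ (all p p<M)))) (sumBelow-1 M)

  gap⇒covers : ∀ {A e p} → e ∈ A → gap e ≡ p → T (covers A p)
  gap⇒covers {e = e} e∈A refl = any⁺ _ (lose e∈A (≡⇒≡ᵇ (gap e) (gap e) refl))

  mult≢0⇒gap : ∀ E {p} → ¬ mult E p ≡ 0 → Σ Edge λ e → e ∈ E × gap e ≡ p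
  mult≢0⇒gap []      nz = ⊥-elim (nz refl)
  mult≢0⇒gap (e ∷ E) {p} nz with gap e ≡ᵇ p in eq
  ... | true  = e , here refl , ≡ᵇ-true⇒≡ eq
  ... | false with mult≢0⇒gap E nz
  ...   | e′ , e′∈E , gap≡p = e′ , there e′∈E , gap≡p

  covers-++ : ∀ A B p → covers (A ++ B) p ≡ covers A p ∨ covers B p
  covers-++ []      B p = refl
  covers-++ (e ∷ A) B p =
    trans (cong ((gap e ≡ᵇ p) ∨_) (covers-++ A B p)) (sym (∨-assoc (gap e ≡ᵇ p) _ _))

  covers-moveʳ : ∀ e A B p → covers (e ∷ A ++ B) p ≡ covers (A ++ e ∷ B) p
  covers-moveʳ e A B p = begin
    (gap e ≡ᵇ p) ∨ covers (A ++ B) p          ≡⟨ cong ((gap e ≡ᵇ p) ∨_) (covers-++ A B p) ⟩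
    (gap e ≡ᵇ p) ∨ (covers A p ∨ covers B p)  ≡⟨ sym (∨-assoc (gap e ≡ᵇ p) _ _) ⟩
    ((gap e ≡ᵇ p) ∨ covers A p) ∨ covers B p  ≡⟨ cong (_∨ covers B p) (∨-comm (gap e ≡ᵇ p) _) ⟩
    (covers A p ∨ (gap e ≡ᵇ p)) ∨ covers B p  ≡⟨ ∨-assoc (covers A p) _ _ ⟩
    covers A p ∨ covers (e ∷ B) p             ≡⟨ sym (covers-++ A (e ∷ B) p) ⟩
    covers (A ++ e ∷ B) p ∎
    where open ≡-Reasoning

  coveredGaps-moveʳ : ∀ e A B → coveredGaps (e ∷ A ++ B) ≡ coveredGaps (A ++ e ∷ B)
  coveredGaps-moveʳ e A B = sumBelow-cong M (λ p _ → cong bit (covers-moveʳ e A B p))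

  coveredGaps-∷ : ∀ {e} B → gap e < M →
                  coveredGaps (e ∷ B) ≡ coveredGaps B + bit (not (covers B (gap e)))
  coveredGaps-∷ {e} B q<M = begin
    sumBelow M (λ p → bit ((gap e ≡ᵇ p) ∨ covers B p))
      ≡⟨ sumBelow-cong M (λ p _ → bit-∨ (gap e ≡ᵇ p) (covers B p)) ⟩
    sumBelow M (λ p → bit (covers B p) + bit ((gap e ≡ᵇ p) ∧ not (covers B p)))
      ≡⟨ sumBelow-+ M _ _ ⟩
    coveredGaps B + sumBelow M (λ p → bit ((gap e ≡ᵇ p) ∧ not (covers B p)))
      ≡⟨ cong (coveredGaps B +_) (sumBelow-indicator M (λ p → not (covers B p)) q<M) ⟩
    coveredGaps B + bit (not (covers B (gap e))) ∎
    where open ≡-Reasoning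

  coveredGaps≤length : ∀ {B} → All (λ e → gap e < M) B → coveredGaps B ≤ length B
  coveredGaps≤length {[]}    []           = ≤-reflexive (sumBelow-zero M (λ _ _ → refl))
  coveredGaps≤length {e ∷ B} (q<M ∷ gaps) rewrite coveredGaps-∷ B q<M =
    subst (coveredGaps B + bit (not (covers B (gap e))) ≤_) (+-comm (length B) 1)
          (+-mono-≤ (coveredGaps≤length gaps) (bit≤1 (not (covers B (gap e)))))

  nullity : List Edge → ℕ
  nullity A = length A ∸ coveredGaps A

  nullity-∷ : ∀ {e} B → gap e < M → All (λ e′ → gap e′ < M) B →
              nullity (e ∷ B) ≡ bit (covers B (gap e)) + nullity B
  nullity-∷ {e} B q<M gaps =
    trans (cong (suc (length B) ∸_) (coveredGaps-∷ B q<M)) (by-coverage (covers B (gap e)))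
    where
      by-coverage : ∀ β → suc (length B) ∸ (coveredGaps B + bit (not β)) ≡ bit β + nullity B
      by-coverage true  = trans (cong (suc (length B) ∸_) (+-identityʳ (coveredGaps B)))
                                (+-∸-assoc 1 (coveredGaps≤length gaps))
      by-coverage false = cong (suc (length B) ∸_) (+-comm (coveredGaps B) 1)

module RingFacts {r ℓ} (R : CommutativeRing r ℓ) where
  open CommutativeRing R
    using (Carrier; _≈_; 0#; 1#; -_; distribˡ; distribʳ; -‿inverseˡ)
    renaming (_+_ to _+ᴿ_; _*_ to _*ᴿ_; _-_ to _-ᴿ_; +-cong to +ᴿ-cong; +-comm to +ᴿ-comm;
              +-assoc to +ᴿ-assoc; +-identityʳ to +ᴿ-identityʳ; *-cong to *ᴿ-cong; *-comm to *ᴿ-comm;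
              *-identityʳ to *ᴿ-identityʳ; *-identityˡ to *ᴿ-identityˡ; *-assoc to *ᴿ-assoc;
              refl to ≈-refl; sym to ≈-sym; trans to ≈-trans)
  open import Relation.Binary.Reasoning.Setoid (CommutativeRing.setoid R)
  open import Algebra.Properties.CommutativeSemigroup (CommutativeRing.*-commutativeSemigroup R)
    using (x∙yz≈y∙xz)

  _^ᴿ_ : Carrier → ℕ → Carrier
  _^ᴿ_ = pow R

  1+[u-1]≈u : ∀ u → 1# +ᴿ (u -ᴿ 1#) ≈ u
  1+[u-1]≈u u = begin
    1# +ᴿ (u -ᴿ 1#)      ≈⟨ +ᴿ-comm 1# (u -ᴿ 1#) ⟩
    (u +ᴿ - 1#) +ᴿ 1#    ≈⟨ +ᴿ-assoc u (- 1#) 1# ⟩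
    u +ᴿ (- 1# +ᴿ 1#)    ≈⟨ +ᴿ-cong ≈-refl (-‿inverseˡ 1#) ⟩
    u +ᴿ 0#              ≈⟨ +ᴿ-identityʳ u ⟩
    u ∎

  u*v≈v+[u-1]*v : ∀ u v → u *ᴿ v ≈ v +ᴿ (u -ᴿ 1#) *ᴿ v
  u*v≈v+[u-1]*v u v = begin
    u *ᴿ v                       ≈⟨ *ᴿ-cong (≈-sym (1+[u-1]≈u u)) ≈-refl ⟩
    (1# +ᴿ (u -ᴿ 1#)) *ᴿ v       ≈⟨ distribʳ v 1# (u -ᴿ 1#) ⟩
    1# *ᴿ v +ᴿ (u -ᴿ 1#) *ᴿ v    ≈⟨ +ᴿ-cong (*ᴿ-identityˡ v) ≈-refl ⟩
    v +ᴿ (u -ᴿ 1#) *ᴿ v ∎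

  prodBelow : ℕ → (ℕ → Carrier) → Carrier
  prodBelow zero    f = 1#
  prodBelow (suc m) f = prodBelow m f *ᴿ f m

  prodBelow-cong : ∀ m {f g : ℕ → Carrier} → (∀ k → k < m → f k ≈ g k) →
                   prodBelow m f ≈ prodBelow m g
  prodBelow-cong zero    eq = ≈-refl
  prodBelow-cong (suc m) eq =
    *ᴿ-cong (prodBelow-cong m (λ k k<m → eq k (m<n⇒m<1+n k<m))) (eq m (n<1+n m))

  prodBelow-linear : ∀ m {q} (f g h : ℕ → Carrier) k → q < m →
    (∀ p → p < m → ¬ p ≡ q → f p ≈ g p) → (∀ p → p < m → ¬ p ≡ q → h p ≈ g p) →
    f q ≈ g q +ᴿ k *ᴿ h q → prodBelow m f ≈ prodBelow m g +ᴿ k *ᴿ prodBelow m h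
  prodBelow-linear (suc m) {q} f g h k q<1+m f≈g h≈g at-q with q ≟ m
  ... | yes refl = begin
    prodBelow q f *ᴿ f q
      ≈⟨ *ᴿ-cong (prodBelow-cong q (λ p p<q → f≈g p (m<n⇒m<1+n p<q) (<⇒≢ p<q))) at-q ⟩
    prodBelow q g *ᴿ (g q +ᴿ k *ᴿ h q)
      ≈⟨ distribˡ (prodBelow q g) (g q) (k *ᴿ h q) ⟩
    prodBelow q g *ᴿ g q +ᴿ prodBelow q g *ᴿ (k *ᴿ h q)
      ≈⟨ +ᴿ-cong ≈-refl (x∙yz≈y∙xz (prodBelow q g) k (h q)) ⟩
    prodBelow q g *ᴿ g q +ᴿ k *ᴿ (prodBelow q g *ᴿ h q)
      ≈⟨ +ᴿ-cong ≈-refl (*ᴿ-cong ≈-refl (*ᴿ-cong (prodBelow-cong q (λ p p<q →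
           ≈-sym (h≈g p (m<n⇒m<1+n p<q) (<⇒≢ p<q)))) ≈-refl)) ⟩
    prodBelow q g *ᴿ g q +ᴿ k *ᴿ (prodBelow q h *ᴿ h q) ∎
  ... | no q≢m = begin
    prodBelow m f *ᴿ f m
      ≈⟨ *ᴿ-cong (prodBelow-linear m f g h k (≤∧≢⇒< (≤-pred q<1+m) q≢m)
                  (λ p p<m → f≈g p (m<n⇒m<1+n p<m)) (λ p p<m → h≈g p (m<n⇒m<1+n p<m)) at-q)
                (f≈g m (n<1+n m) (q≢m ∘ sym)) ⟩
    (prodBelow m g +ᴿ k *ᴿ prodBelow m h) *ᴿ g m
      ≈⟨ distribʳ (g m) (prodBelow m g) (k *ᴿ prodBelow m h) ⟩
    prodBelow m g *ᴿ g m +ᴿ (k *ᴿ prodBelow m h) *ᴿ g m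
      ≈⟨ +ᴿ-cong ≈-refl (*ᴿ-assoc k (prodBelow m h) (g m)) ⟩
    prodBelow m g *ᴿ g m +ᴿ k *ᴿ (prodBelow m h *ᴿ g m)
      ≈⟨ +ᴿ-cong ≈-refl (*ᴿ-cong ≈-refl (*ᴿ-cong ≈-refl (≈-sym (h≈g m (n<1+n m) (q≢m ∘ sym))))) ⟩
    prodBelow m g *ᴿ g m +ᴿ k *ᴿ (prodBelow m h *ᴿ h m) ∎

  prodBelow-if : ∀ m (t : ℕ → Bool) z →
    prodBelow m (λ p → if t p then 1# else z) ≈ z ^ᴿ (m ∸ sumBelow m (λ p → bit (t p)))
  prodBelow-if zero    t z = ≈-refl
  prodBelow-if (suc m) t z with t m
  ... | true  rewrite +-comm (sumBelow m (λ p → bit (t p))) 1 =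
    ≈-trans (*ᴿ-identityʳ _) (prodBelow-if m t z)
  ... | false rewrite +-identityʳ (sumBelow m (λ p → bit (t p)))
                    | +-∸-assoc 1 (sumBelow-bit≤ m t) =
    ≈-trans (*ᴿ-cong (prodBelow-if m t z) ≈-refl) (*ᴿ-comm _ z)

  -- For k ≥ 1, the Tutte polynomial x + y + ⋯ + y^(k-1) of k parallel edges.
  bundle : Carrier → Carrier → ℕ → Carrier
  bundle x y zero    = x -ᴿ 1#
  bundle x y (suc k) = bundle x y k +ᴿ y ^ᴿ k

  bundle-1 : ∀ x y → bundle x y 1 ≈ x
  bundle-1 x y = ≈-trans (+ᴿ-comm (x -ᴿ 1#) 1#) (1+[u-1]≈u x)

  bundle-2 : ∀ x y → bundle x y 2 ≈ y +ᴿ x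
  bundle-2 x y = ≈-trans (+ᴿ-cong (bundle-1 x y) (*ᴿ-identityʳ y)) (+ᴿ-comm x y)

  prodBelow-alternating : ∀ m u v →
    prodBelow (suc (double m)) (λ p → if isEven p then u else v) ≈ u ^ᴿ suc m *ᴿ v ^ᴿ m
  prodBelow-alternating zero    u v =
    ≈-trans (*ᴿ-identityˡ u) (≈-sym (≈-trans (*ᴿ-identityʳ _) (*ᴿ-identityʳ u)))
  prodBelow-alternating (suc m) u v = begin
    (prodBelow (suc (double m)) f *ᴿ f (suc (double m))) *ᴿ f (suc (suc (double m)))
      ≡⟨ cong₂ (λ β γ → (prodBelow (suc (double m)) f *ᴿ (if β then u else v)) *ᴿ (if γ then u else v))
               (cong not (isEven-double m)) (cong (not ∘ not) (isEven-double m)) ⟩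
    (prodBelow (suc (double m)) f *ᴿ v) *ᴿ u
      ≈⟨ *ᴿ-cong (*ᴿ-cong (prodBelow-alternating m u v) ≈-refl) ≈-refl ⟩
    ((u ^ᴿ suc m *ᴿ v ^ᴿ m) *ᴿ v) *ᴿ u
      ≈⟨ *ᴿ-comm _ u ⟩
    u *ᴿ ((u ^ᴿ suc m *ᴿ v ^ᴿ m) *ᴿ v)
      ≈⟨ *ᴿ-cong ≈-refl (*ᴿ-assoc (u ^ᴿ suc m) (v ^ᴿ m) v) ⟩
    u *ᴿ (u ^ᴿ suc m *ᴿ (v ^ᴿ m *ᴿ v))
      ≈⟨ ≈-sym (*ᴿ-assoc u (u ^ᴿ suc m) _) ⟩
    (u *ᴿ u ^ᴿ suc m) *ᴿ (v ^ᴿ m *ᴿ v)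
      ≈⟨ *ᴿ-cong ≈-refl (*ᴿ-comm (v ^ᴿ m) v) ⟩
    u ^ᴿ suc (suc m) *ᴿ v ^ᴿ suc m ∎
    where
      f : ℕ → Carrier
      f p = if isEven p then u else v

module SubsetSums {r ℓ} (R : CommutativeRing r ℓ) {V : Set} (_≟_ : DecidableEquality V)
                  (gap : V × V → ℕ) (M : ℕ) (x y : CommutativeRing.Carrier R) where
  open CommutativeRing R
    using (Carrier; _≈_; 0#; 1#; distribˡ)
    renaming (_+_ to _+ᴿ_; _*_ to _*ᴿ_; _-_ to _-ᴿ_; +-cong to +ᴿ-cong; +-assoc to +ᴿ-assoc;
              +-identityˡ to +ᴿ-identityˡ; +-identityʳ to +ᴿ-identityʳ; *-cong to *ᴿ-cong;
              *-comm to *ᴿ-comm; *-identityˡ to *ᴿ-identityˡ;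
              refl to ≈-refl; sym to ≈-sym; trans to ≈-trans; reflexive to ≈-reflexive)
  open import Relation.Binary.Reasoning.Setoid (CommutativeRing.setoid R)
  open import Algebra.Properties.CommutativeSemigroup (CommutativeRing.*-commutativeSemigroup R)
    using (xy∙z≈y∙xz)
  open RingFacts R
  open GraphTheory _≟_ using (sublists)
  open GapCount gap M

  nullityTerm : List (V × V) → Carrier
  nullityTerm A = (y -ᴿ 1#) ^ᴿ nullity A

  -- Once r(A) = coveredGaps A and r(E) = M are known, term A is the summand of T at A ⊆ E.
  term : List (V × V) → Carrier
  term A = ((x -ᴿ 1#) ^ᴿ (M ∸ coveredGaps A)) *ᴿ nullityTerm A

  sumOver : {X : Set} → (X → Carrier) → List X → Carrier
  sumOver t = foldr (λ A acc → t A +ᴿ acc) 0#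

  sumOver-++ : ∀ {X : Set} (t : X → Carrier) L₁ L₂ →
               sumOver t (L₁ ++ L₂) ≈ sumOver t L₁ +ᴿ sumOver t L₂
  sumOver-++ t []       L₂ = ≈-sym (+ᴿ-identityˡ _)
  sumOver-++ t (A ∷ L₁) L₂ = ≈-trans (+ᴿ-cong ≈-refl (sumOver-++ t L₁ L₂)) (≈-sym (+ᴿ-assoc _ _ _))

  sumOver-map : ∀ {X Y : Set} (t : Y → Carrier) (h : X → Y) L →
                sumOver t (map h L) ≡ sumOver (λ A → t (h A)) L
  sumOver-map t h []      = refl
  sumOver-map t h (A ∷ L) = cong (t (h A) +ᴿ_) (sumOver-map t h L)

  sumOver-cong : ∀ {X : Set} {t t′ : X → Carrier} L → (∀ {A} → A ∈ L → t A ≡ t′ A) →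
                 sumOver t L ≡ sumOver t′ L
  sumOver-cong []      eq = refl
  sumOver-cong (A ∷ L) eq = cong₂ _+ᴿ_ (eq (here refl)) (sumOver-cong L (eq ∘ there))

  subsetSum : List (V × V) → List (V × V) → Carrier
  subsetSum E B = sumOver (λ A → term (A ++ B)) (sublists E)

  -- The sum over the subsets of the edges of E at gap p, given whether B already covers p.
  factor : List (V × V) → List (V × V) → ℕ → Carrier
  factor E B p = if covers B p then y ^ᴿ mult E p else bundle x y (mult E p)

  term-moveʳ : ∀ e A B → term (e ∷ A ++ B) ≡ term (A ++ e ∷ B)
  term-moveʳ e A B =
    cong₂ (λ h l → ((x -ᴿ 1#) ^ᴿ (M ∸ h)) *ᴿ ((y -ᴿ 1#) ^ᴿ (l ∸ h)))
          (coveredGaps-moveʳ e A B) (sym (length-++-sucʳ A e B))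

  subsetSum-∷ : ∀ e E B → subsetSum (e ∷ E) B ≈ subsetSum E B +ᴿ subsetSum E (e ∷ B)
  subsetSum-∷ e E B = begin
    sumOver (λ A → term (A ++ B)) (sublists E ++ map (e ∷_) (sublists E))
      ≈⟨ sumOver-++ _ (sublists E) _ ⟩
    subsetSum E B +ᴿ sumOver (λ A → term (A ++ B)) (map (e ∷_) (sublists E))
      ≡⟨ cong (subsetSum E B +ᴿ_) (trans (sumOver-map _ (e ∷_) (sublists E))
                                        (sumOver-cong (sublists E) (λ {A} _ → term-moveʳ e A B))) ⟩
    subsetSum E B +ᴿ subsetSum E (e ∷ B) ∎

  factor-covered : ∀ E B p → covers B p ≡ true → factor E B p ≡ y ^ᴿ mult E p
  factor-covered E B p = cong (λ β → if β then y ^ᴿ mult E p else bundle x y (mult E p))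

  factor-uncovered : ∀ E B p → covers B p ≡ false → factor E B p ≡ bundle x y (mult E p)
  factor-uncovered E B p = cong (λ β → if β then y ^ᴿ mult E p else bundle x y (mult E p))

  covers-∷-gap : ∀ e B → covers (e ∷ B) (gap e) ≡ true
  covers-∷-gap e B = cong (_∨ covers B (gap e)) (≡⇒≡ᵇ-true {gap e} refl)

  mult-∷-gap : ∀ e E → mult (e ∷ E) (gap e) ≡ suc (mult E (gap e))
  mult-∷-gap e E = cong (λ β → bit β + mult E (gap e)) (≡⇒≡ᵇ-true {gap e} refl)

  factor-∷ˡ : ∀ {e} E B {p} → ¬ p ≡ gap e → factor (e ∷ E) B p ≡ factor E B p
  factor-∷ˡ {e} E B {p} p≢q =
    cong (λ β → if covers B p then y ^ᴿ (bit β + mult E p) else bundle x y (bit β + mult E p))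
         (≢⇒≡ᵇ-false (p≢q ∘ sym))

  factor-∷ʳ : ∀ {e} E B {p} → ¬ p ≡ gap e → factor E (e ∷ B) p ≡ factor E B p
  factor-∷ʳ {e} E B {p} p≢q =
    cong (λ β → if β ∨ covers B p then y ^ᴿ mult E p else bundle x y (mult E p)) (≢⇒≡ᵇ-false (p≢q ∘ sym))

  ConsFactor : V × V → List (V × V) → List (V × V) → Carrier → Set ℓ
  ConsFactor e E B k = nullityTerm (e ∷ B) ≈ k *ᴿ nullityTerm B ×
                       factor (e ∷ E) B (gap e) ≈ factor E B (gap e) +ᴿ k *ᴿ factor E (e ∷ B) (gap e)

  consFactor-covered : ∀ {e} E B → gap e < M → All (λ e′ → gap e′ < M) B →
                       covers B (gap e) ≡ true → ConsFactor e E B (y -ᴿ 1#)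
  consFactor-covered {e} E B q<M gaps covered =
    ≈-reflexive (cong ((y -ᴿ 1#) ^ᴿ_) (trans (nullity-∷ B q<M gaps)
                                              (cong (λ β → bit β + nullity B) covered))) ,
    (begin
      factor (e ∷ E) B (gap e)
        ≡⟨ trans (factor-covered (e ∷ E) B (gap e) covered) (cong (y ^ᴿ_) (mult-∷-gap e E)) ⟩
      y *ᴿ y ^ᴿ m
        ≈⟨ u*v≈v+[u-1]*v y (y ^ᴿ m) ⟩
      y ^ᴿ m +ᴿ (y -ᴿ 1#) *ᴿ y ^ᴿ m
        ≡⟨ sym (cong₂ (λ u v → u +ᴿ (y -ᴿ 1#) *ᴿ v) (factor-covered E B (gap e) covered)
                                                    (factor-covered E (e ∷ B) (gap e) (covers-∷-gap e B))) ⟩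
      factor E B (gap e) +ᴿ (y -ᴿ 1#) *ᴿ factor E (e ∷ B) (gap e) ∎)
    where m = mult E (gap e)

  consFactor-uncovered : ∀ {e} E B → gap e < M → All (λ e′ → gap e′ < M) B →
                         covers B (gap e) ≡ false → ConsFactor e E B 1#
  consFactor-uncovered {e} E B q<M gaps uncovered =
    ≈-trans (≈-reflexive (cong ((y -ᴿ 1#) ^ᴿ_) (trans (nullity-∷ B q<M gaps)
                                                       (cong (λ β → bit β + nullity B) uncovered))))
            (≈-sym (*ᴿ-identityˡ _)) ,
    (begin
      factor (e ∷ E) B (gap e)
        ≡⟨ trans (factor-uncovered (e ∷ E) B (gap e) uncovered) (cong (bundle x y) (mult-∷-gap e E)) ⟩
      bundle x y m +ᴿ y ^ᴿ m
        ≈⟨ +ᴿ-cong ≈-refl (≈-sym (*ᴿ-identityˡ _)) ⟩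
      bundle x y m +ᴿ 1# *ᴿ y ^ᴿ m
        ≡⟨ sym (cong₂ (λ u v → u +ᴿ 1# *ᴿ v) (factor-uncovered E B (gap e) uncovered)
                                              (factor-covered E (e ∷ B) (gap e) (covers-∷-gap e B))) ⟩
      factor E B (gap e) +ᴿ 1# *ᴿ factor E (e ∷ B) (gap e) ∎)
    where m = mult E (gap e)

  consFactor : ∀ {e} E B → gap e < M → All (λ e′ → gap e′ < M) B → Σ Carrier (ConsFactor e E B)
  consFactor {e} E B q<M gaps = by-coverage (covers B (gap e)) refl
    where
      by-coverage : ∀ β → covers B (gap e) ≡ β → Σ Carrier (ConsFactor e E B)
      by-coverage true  covered   = y -ᴿ 1# , consFactor-covered E B q<M gaps covered
      by-coverage false uncovered = 1# , consFactor-uncovered E B q<M gaps uncovered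

  subsetSum-factorises : ∀ E B → All (λ e → gap e < M) E → All (λ e → gap e < M) B →
                         subsetSum E B ≈ nullityTerm B *ᴿ prodBelow M (factor E B)
  subsetSum-factorises [] B _ _ = begin
    term B +ᴿ 0#
      ≈⟨ +ᴿ-identityʳ _ ⟩
    (x -ᴿ 1#) ^ᴿ (M ∸ coveredGaps B) *ᴿ nullityTerm B
      ≈⟨ *ᴿ-comm _ _ ⟩
    nullityTerm B *ᴿ (x -ᴿ 1#) ^ᴿ (M ∸ coveredGaps B)
      ≈⟨ *ᴿ-cong ≈-refl (≈-sym (prodBelow-if M (covers B) (x -ᴿ 1#))) ⟩
    nullityTerm B *ᴿ prodBelow M (factor [] B) ∎
  subsetSum-factorises (e ∷ E) B (q<M ∷ gapsE) gapsB with consFactor E B q<M gapsB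
  ... | k , nullity≈ , at-q = begin
    subsetSum (e ∷ E) B
      ≈⟨ subsetSum-∷ e E B ⟩
    subsetSum E B +ᴿ subsetSum E (e ∷ B)
      ≈⟨ +ᴿ-cong (subsetSum-factorises E B gapsE gapsB)
                 (subsetSum-factorises E (e ∷ B) gapsE (q<M ∷ gapsB)) ⟩
    nullityTerm B *ᴿ prodBelow M (factor E B) +ᴿ nullityTerm (e ∷ B) *ᴿ prodBelow M (factor E (e ∷ B))
      ≈⟨ +ᴿ-cong ≈-refl (≈-trans (*ᴿ-cong nullity≈ ≈-refl) (xy∙z≈y∙xz k _ _)) ⟩
    nullityTerm B *ᴿ prodBelow M (factor E B) +ᴿ nullityTerm B *ᴿ (k *ᴿ prodBelow M (factor E (e ∷ B)))
      ≈⟨ ≈-sym (distribˡ (nullityTerm B) _ _) ⟩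
    nullityTerm B *ᴿ (prodBelow M (factor E B) +ᴿ k *ᴿ prodBelow M (factor E (e ∷ B)))
      ≈⟨ *ᴿ-cong ≈-refl (≈-sym (prodBelow-linear M (factor (e ∷ E) B) (factor E B) (factor E (e ∷ B)) k q<M
            (λ p _ p≢q → ≈-reflexive (factor-∷ˡ E B p≢q))
            (λ p _ p≢q → ≈-reflexive (factor-∷ʳ E B p≢q)) at-q)) ⟩
    nullityTerm B *ᴿ prodBelow M (factor (e ∷ E) B) ∎

-- Components of spanning subgraphs of a path

module GraphFacts {V : Set} (_≟_ : DecidableEquality V) where
  open GraphTheory _≟_

  Adjacent : List (V × V) → V → V → Set
  Adjacent A u w = (u , w) ∈ A ⊎ (w , u) ∈ A

  eqb-refl : ∀ w → T (eqb w w)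
  eqb-refl w = fromWitness {a? = w ≟ w} refl

  Joins : (V → Bool) → V → V × V → Set
  Joins S w e = T ((S (proj₁ e) ∧ eqb (proj₂ e) w) ∨ (S (proj₂ e) ∧ eqb (proj₁ e) w))

  step-adjacent : ∀ A S {u w} → Adjacent A u w → T (S u) → T (step A S w)
  step-adjacent A S {u} {w} adj Su = from T-∨ (inj₂ (any⁺ _ (witness adj)))
    where
      Su∧w : T (S u ∧ eqb w w)
      Su∧w = from T-∧ (Su , eqb-refl w)
      witness : Adjacent A u w → Any (Joins S w) A
      witness (inj₁ uw∈A) = lose uw∈A (from T-∨ (inj₁ Su∧w))
      witness (inj₂ wu∈A) = lose wu∈A (from T-∨ (inj₂ Su∧w))

  joins⇒adjacent : ∀ {A S w e} → e ∈ A → Joins S w e → Σ V λ u → T (S u) × Adjacent A u w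
  joins⇒adjacent {A} {e = e} e∈A joins with to T-∨ joins
  ... | inj₁ h = let Su , w≡ = to T-∧ h in
    proj₁ e , Su , inj₁ (subst (λ z → (proj₁ e , z) ∈ A) (toWitness w≡) e∈A)
  ... | inj₂ h = let Su , w≡ = to T-∧ h in
    proj₂ e , Su , inj₂ (subst (λ z → (z , proj₂ e) ∈ A) (toWitness w≡) e∈A)

  step-sound : ∀ A S {w} → T (step A S w) → T (S w) ⊎ Σ V λ u → T (S u) × Adjacent A u w
  step-sound A S {w} Sw′ with to T-∨ Sw′
  ... | inj₁ Sw   = inj₁ Sw
  ... | inj₂ some = let e , e∈A , joins = find (any⁻ _ A some) in inj₂ (joins⇒adjacent e∈A joins)

  ∈-sublists⁻ : ∀ {X : Set} (E : List X) {A} → A ∈ sublists E → ∀ {e} → e ∈ A → e ∈ E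
  ∈-sublists⁻ []      (here refl) ()
  ∈-sublists⁻ (f ∷ E) A∈ e∈A with ∈-++⁻ (sublists E) A∈
  ... | inj₁ A∈s = there (∈-sublists⁻ E A∈s e∈A)
  ... | inj₂ A∈m with ∈-map⁻ (f ∷_) A∈m
  ...   | A′ , A′∈s , refl with e∈A
  ...     | here refl  = here refl
  ...     | there e∈A′ = there (∈-sublists⁻ E A′∈s e∈A′)

  module KeyedComponents (vs : List V) (A : List (V × V)) (key : V → ℕ) (N : ℕ)
                         (key<N : ∀ v → key v < N)
                         (connected≡ : ∀ u v → connected vs A u v ≡ (key u ≡ᵇ key v)) where

    keyOccurs : List V → ℕ → Bool
    keyOccurs L k = any (λ u → key u ≡ᵇ k) L

    componentsAux-keys : ∀ E L → componentsAux vs A E L ≡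
      sumBelow N (λ k → bit (keyOccurs L k ∧ not (keyOccurs E k)))
    componentsAux-keys E []      = sym (sumBelow-zero N (λ _ _ → refl))
    componentsAux-keys E (v ∷ L) = begin
      (if any (λ u → connected vs A u v) E then 0 else 1) + componentsAux vs A (v ∷ E) L
        ≡⟨ cong₂ _+_ (trans (cong (λ β → if β then 0 else 1) (cong or (map-cong (λ u → connected≡ u v) E)))
                            (if-not (keyOccurs E (key v))))
                     (componentsAux-keys (v ∷ E) L) ⟩
      bit (not (keyOccurs E (key v))) + sumBelow N (λ k → bit (keyOccurs L k ∧ not (keyOccurs (v ∷ E) k)))
        ≡⟨ cong (_+ sumBelow N (λ k → bit (keyOccurs L k ∧ not (keyOccurs (v ∷ E) k))))
                (sym (sumBelow-indicator N (λ k → not (keyOccurs E k)) (key<N v))) ⟩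
      sumBelow N (λ k → bit ((key v ≡ᵇ k) ∧ not (keyOccurs E k)))
        + sumBelow N (λ k → bit (keyOccurs L k ∧ not (keyOccurs (v ∷ E) k)))
        ≡⟨ sym (sumBelow-+ N _ _) ⟩
      sumBelow N (λ k → bit ((key v ≡ᵇ k) ∧ not (keyOccurs E k))
                      + bit (keyOccurs L k ∧ not ((key v ≡ᵇ k) ∨ keyOccurs E k)))
        ≡⟨ sumBelow-cong N (λ k _ → sym (bit-∨∧not (key v ≡ᵇ k) (keyOccurs L k) (keyOccurs E k))) ⟩
      sumBelow N (λ k → bit (keyOccurs (v ∷ L) k ∧ not (keyOccurs E k))) ∎
      where
        open ≡-Reasoning
        if-not : ∀ β → (if β then 0 else 1) ≡ bit (not β)
        if-not true  = refl
        if-not false = refl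

    components-keys : components vs A ≡ sumBelow N (λ k → bit (keyOccurs vs k))
    components-keys = trans (componentsAux-keys [] vs)
                            (sumBelow-cong N (λ k _ → cong bit (∧-identityʳ (keyOccurs vs k))))

record PathNumbering {V : Set} (vs : List V) (M : ℕ) : Set where
  field
    pos             : V → ℕ
    pos-injective   : ∀ {u v} → pos u ≡ pos v → u ≡ v
    pos≤M           : ∀ v → pos v ≤ M
    vertexAt        : ∀ {k} → k ≤ M → Σ V λ v → pos v ≡ k
    ∈-vertices      : ∀ v → v ∈ vs
    length-vertices : length vs ≡ suc M

module PathGraph {V : Set} (_≟_ : DecidableEquality V) {vs : List V} {M : ℕ}
                 (P : PathNumbering vs M) where
  open GraphTheory _≟_
  open GraphFacts _≟_
  open PathNumbering P

  gap : V × V → ℕ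
  gap e = pos (proj₁ e) ⊓ pos (proj₂ e)

  open GapCount gap M public

  IsLink : V × V → Set
  IsLink e = pos (proj₂ e) ≡ suc (pos (proj₁ e)) ⊎ pos (proj₁ e) ≡ suc (pos (proj₂ e))

  link-ends : ∀ {e} → IsLink e →
    (pos (proj₁ e) ≡ gap e × pos (proj₂ e) ≡ suc (gap e)) ⊎
    (pos (proj₁ e) ≡ suc (gap e) × pos (proj₂ e) ≡ gap e)
  link-ends {e} (inj₁ eq) rewrite eq | m≤n⇒m⊓n≡m (n≤1+n (pos (proj₁ e))) = inj₁ (refl , refl)
  link-ends {e} (inj₂ eq) rewrite eq | m≥n⇒m⊓n≡n (n≤1+n (pos (proj₂ e))) = inj₂ (refl , refl)

  link-gap<M : ∀ {e} → IsLink e → gap e < M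
  link-gap<M {e} link with link-ends link
  ... | inj₁ (_ , eq) = subst (_≤ M) eq (pos≤M (proj₂ e))
  ... | inj₂ (eq , _) = subst (_≤ M) eq (pos≤M (proj₁ e))

  module Blocks (A : List (V × V)) (links : ∀ {e} → e ∈ A → IsLink e) where

    -- The components of (vs , A) are intervals of positions; blockStart p is the left end of p's.
    blockStart : ℕ → ℕ
    blockStart zero    = zero
    blockStart (suc p) = if covers A p then blockStart p else suc p

    blockStart≤ : ∀ p → blockStart p ≤ p
    blockStart≤ zero = z≤n
    blockStart≤ (suc p) with covers A p
    ... | true  = m≤n⇒m≤1+n (blockStart≤ p)
    ... | false = ≤-refl

    blockStart≤blockStart-suc : ∀ p → blockStart p ≤ blockStart (suc p)
    blockStart≤blockStart-suc p with covers A p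
    ... | true  = ≤-refl
    ... | false = m≤n⇒m≤1+n (blockStart≤ p)

    blockStart-mono : ∀ {p q} → p ≤ q → blockStart p ≤ blockStart q
    blockStart-mono p≤q = mono (≤⇒≤′ p≤q)
      where
        mono : ∀ {p q} → p ≤′ q → blockStart p ≤ blockStart q
        mono ≤′-refl              = ≤-refl
        mono (≤′-step {q} p≤′q) = ≤-trans (mono p≤′q) (blockStart≤blockStart-suc q)

    blockStart-squeeze : ∀ {p m q} → p ≤ m → m ≤ q → blockStart p ≡ blockStart q →
                         blockStart m ≡ blockStart q
    blockStart-squeeze p≤m m≤q eq =
      ≤-antisym (blockStart-mono m≤q) (subst (_≤ _) eq (blockStart-mono p≤m))

    covered⇒blockStart-suc : ∀ {p} → T (covers A p) → blockStart (suc p) ≡ blockStart p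
    covered⇒blockStart-suc {p} h with covers A p
    ... | true = refl

    blockStart-suc⇒covered : ∀ {p} → blockStart (suc p) ≡ blockStart p → T (covers A p)
    blockStart-suc⇒covered {p} eq with covers A p
    ... | true  = _
    ... | false = ⊥-elim (<⇒≢ (s≤s (blockStart≤ p)) (sym eq))

    blockStart-idem : ∀ p → blockStart (blockStart p) ≡ blockStart p
    blockStart-idem zero = refl
    blockStart-idem (suc p) with covers A p in eq
    ... | true  = blockStart-idem p
    ... | false = cong (λ β → if β then blockStart p else suc p) eq

    isBlockStart-suc : ∀ p → (blockStart (suc p) ≡ᵇ suc p) ≡ not (covers A p)
    isBlockStart-suc p with covers A p
    ... | true  = ≢⇒≡ᵇ-false (<⇒≢ (s≤s (blockStart≤ p)))
    ... | false = ≡⇒≡ᵇ-true {suc p} refl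

    SameBlock : V → V → Set
    SameBlock u v = blockStart (pos u) ≡ blockStart (pos v)

    link-sameBlock : ∀ {e} → e ∈ A → SameBlock (proj₁ e) (proj₂ e)
    link-sameBlock {e} e∈A with link-ends (links e∈A)
    ... | inj₁ (p₁ , p₂) =
      trans (cong blockStart p₁) (trans (sym (covered⇒blockStart-suc covered)) (cong blockStart (sym p₂)))
      where covered = gap⇒covers e∈A refl
    ... | inj₂ (p₁ , p₂) =
      trans (cong blockStart p₁) (trans (covered⇒blockStart-suc covered) (cong blockStart (sym p₂)))
      where covered = gap⇒covers e∈A refl

    adjacent-sameBlock : ∀ {u w} → Adjacent A u w → SameBlock u w
    adjacent-sameBlock (inj₁ uw∈A) = link-sameBlock uw∈A
    adjacent-sameBlock (inj₂ wu∈A) = sym (link-sameBlock wu∈A)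

    adjacent-link : ∀ {u w} → Adjacent A u w → pos w ≡ suc (pos u) ⊎ pos u ≡ suc (pos w)
    adjacent-link (inj₁ uw∈A) = links uw∈A
    adjacent-link (inj₂ wu∈A) = swap (links wu∈A)

    covered⇒adjacent : ∀ {j u w} → T (covers A j) → pos u ≡ j → pos w ≡ suc j → Adjacent A u w
    covered⇒adjacent {j} h pu pw with find (any⁻ _ A h)
    ... | e , e∈A , gap≡j with ≡ᵇ⇒≡ (gap e) j gap≡j | link-ends (links e∈A)
    ... | refl | inj₁ (p₁ , p₂) =
      inj₁ (subst₂ (λ s t → (s , t) ∈ A) (pos-injective (trans p₁ (sym pu)))
                                         (pos-injective (trans p₂ (sym pw))) e∈A)
    ... | refl | inj₂ (p₁ , p₂) =
      inj₂ (subst₂ (λ s t → (s , t) ∈ A) (pos-injective (trans p₁ (sym pw)))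
                                         (pos-injective (trans p₂ (sym pu))) e∈A)

    reach : ℕ → V → V → Bool
    reach k v = iter k (step A) (eqb v)

    Near : ℕ → V → V → Set
    Near k v w = pos w ≤ k + pos v × pos v ≤ k + pos w

    near-step : ∀ {k v u w} → Near k v u → pos w ≡ suc (pos u) ⊎ pos u ≡ suc (pos w) →
                Near (suc k) v w
    near-step {k} {v} {u} {w} (h₁ , h₂) (inj₁ eq) rewrite eq =
      s≤s h₁ , ≤-trans h₂ (+-mono-≤ (n≤1+n k) (n≤1+n (pos u)))
    near-step {k} {v} {u} {w} (h₁ , h₂) (inj₂ eq) =
      ≤-trans (≤-trans (n≤1+n (pos w)) (≤-reflexive (sym eq))) (m≤n⇒m≤1+n h₁) ,
      subst (pos v ≤_) (trans (cong (k +_) eq) (+-suc k (pos w))) h₂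

    reach-sound : ∀ k {v w} → T (reach k v w) → Near k v w × SameBlock v w
    reach-sound zero {v} {w} h with toWitness {a? = v ≟ w} h
    ... | refl = (≤-refl , ≤-refl) , refl
    reach-sound (suc k) {v} h with step-sound A (reach k v) h
    ... | inj₁ h′ with reach-sound k h′
    ...   | (n₁ , n₂) , sb = (m≤n⇒m≤1+n n₁ , m≤n⇒m≤1+n n₂) , sb
    reach-sound (suc k) {v} h | inj₂ (u , h′ , adj) with reach-sound k h′
    ...   | near , sb = near-step near (adjacent-link adj) , trans sb (adjacent-sameBlock adj)

    Predecessor : ℕ → V → V → Set
    Predecessor k v w = Σ V λ u → Near k v u × SameBlock v u × Adjacent A u w

    predecessor-right : ∀ {k v w} → pos w ≡ suc (k + pos v) → SameBlock v w → Predecessor k v w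
    predecessor-right {k} {v} {w} pw≡ sb = u , near , sb′ , covered⇒adjacent covered pu pw≡
      where
        j : ℕ
        j = k + pos v
        j≤M : j ≤ M
        j≤M = ≤-trans (n≤1+n j) (subst (_≤ M) pw≡ (pos≤M w))
        u : V
        u = proj₁ (vertexAt j≤M)
        pu : pos u ≡ j
        pu = proj₂ (vertexAt j≤M)
        squeezed : blockStart j ≡ blockStart (pos w)
        squeezed = blockStart-squeeze (m≤n+m (pos v) k) (≤-trans (n≤1+n j) (≤-reflexive (sym pw≡))) sb
        covered : T (covers A j)
        covered = blockStart-suc⇒covered (trans (cong blockStart (sym pw≡)) (sym squeezed))
        sb′ : SameBlock v u
        sb′ = trans sb (sym (trans (cong blockStart pu) squeezed))
        near : Near k v u
        near = ≤-reflexive pu ,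
               subst (λ z → pos v ≤ k + z) (sym pu) (≤-trans (m≤n+m (pos v) k) (m≤n+m j k))

    predecessor-left : ∀ {k v w} → pos v ≡ suc (k + pos w) → SameBlock v w → Predecessor k v w
    predecessor-left {k} {v} {w} pv≡ sb = u , near , sb′ , swap (covered⇒adjacent covered refl pu)
      where
        next≤pv : suc (pos w) ≤ pos v
        next≤pv = subst (suc (pos w) ≤_) (sym pv≡) (s≤s (m≤n+m (pos w) k))
        u : V
        u = proj₁ (vertexAt (≤-trans next≤pv (pos≤M v)))
        pu : pos u ≡ suc (pos w)
        pu = proj₂ (vertexAt (≤-trans next≤pv (pos≤M v)))
        squeezed : blockStart (suc (pos w)) ≡ blockStart (pos v)
        squeezed = blockStart-squeeze (n≤1+n (pos w)) next≤pv (sym sb)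
        covered : T (covers A (pos w))
        covered = blockStart-suc⇒covered (trans squeezed sb)
        sb′ : SameBlock v u
        sb′ = sym (trans (cong blockStart pu) squeezed)
        near : Near k v u
        near = subst (_≤ k + pos v) (sym pu) (≤-trans next≤pv (m≤n+m (pos v) k)) ,
               ≤-reflexive (trans pv≡ (trans (sym (+-suc k (pos w))) (cong (k +_) (sym pu))))

    reach-via : ∀ {k v w} → (∀ {u} → Near k v u → SameBlock v u → T (reach k v u)) →
                Predecessor k v w → T (reach (suc k) v w)
    reach-via {k} {v} reach-k (u , near , sb , adj) = step-adjacent A (reach k v) adj (reach-k near sb)

    reach-complete : ∀ k {v w} → Near k v w → SameBlock v w → T (reach k v w)
    reach-complete zero {v} (h₁ , h₂) sb with pos-injective (≤-antisym h₂ h₁)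
    ... | refl = eqb-refl v
    reach-complete (suc k) {v} {w} (h₁ , h₂) sb with pos w ≤? k + pos v | pos v ≤? k + pos w
    ... | yes h₁′ | yes h₂′ = from T-∨ (inj₁ (reach-complete k (h₁′ , h₂′) sb))
    ... | no  far | _       = reach-via (reach-complete k) (predecessor-right (≤-antisym h₁ (≰⇒> far)) sb)
    ... | yes _   | no  far = reach-via (reach-complete k) (predecessor-left  (≤-antisym h₂ (≰⇒> far)) sb)

    connected≡sameBlock : ∀ v w → connected vs A v w ≡ (blockStart (pos v) ≡ᵇ blockStart (pos w))
    connected≡sameBlock v w = ⇔→≡ {z = true} (mk⇔
      (λ h → to T-≡ (≡⇒≡ᵇ _ _ (proj₂ (reach-sound (length vs) (from T-≡ h)))))
      (λ h → to T-≡ (reach-complete (length vs) (near w v , near v w) (≡ᵇ⇒≡ _ _ (from T-≡ h)))))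
      where
        near : ∀ u u′ → pos u ≤ length vs + pos u′
        near u u′ rewrite length-vertices =
          ≤-trans (pos≤M u) (≤-trans (n≤1+n M) (m≤m+n (suc M) (pos u′)))

    open KeyedComponents vs A (λ v → blockStart (pos v)) (suc M)
                         (λ v → s≤s (≤-trans (blockStart≤ _) (pos≤M v))) connected≡sameBlock

    blockStart-occurs : ∀ {k} → k ≤ M → keyOccurs vs k ≡ (blockStart k ≡ᵇ k)
    blockStart-occurs {k} k≤M = ⇔→≡ {z = true} (mk⇔ occurs⇒start start⇒occurs)
      where
        occurs⇒start : keyOccurs vs k ≡ true → (blockStart k ≡ᵇ k) ≡ true
        occurs⇒start h with find (any⁻ _ vs (from T-≡ h))
        ... | u , _ , hit with ≡ᵇ⇒≡ (blockStart (pos u)) k hit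
        ... | refl = ≡⇒≡ᵇ-true (blockStart-idem (pos u))
        start⇒occurs : (blockStart k ≡ᵇ k) ≡ true → keyOccurs vs k ≡ true
        start⇒occurs h = to T-≡ (any⁺ _ (lose (∈-vertices u)
                           (≡⇒≡ᵇ _ _ (trans (cong blockStart pu) (≡ᵇ-true⇒≡ h)))))
          where
            u : V
            u = proj₁ (vertexAt k≤M)
            pu : pos u ≡ k
            pu = proj₂ (vertexAt k≤M)

    components-path : components vs A ≡ suc (sumBelow M (λ p → bit (not (covers A p))))
    components-path = begin
      components vs A
        ≡⟨ components-keys ⟩
      sumBelow (suc M) (λ k → bit (keyOccurs vs k))
        ≡⟨ sumBelow-cong (suc M) (λ k k<1+M → cong bit (blockStart-occurs (≤-pred k<1+M))) ⟩
      sumBelow (suc M) (λ k → bit (blockStart k ≡ᵇ k))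
        ≡⟨ sumBelow-suc M _ ⟩
      suc (sumBelow M (λ p → bit (blockStart (suc p) ≡ᵇ suc p)))
        ≡⟨ cong suc (sumBelow-cong M (λ p _ → cong bit (isBlockStart-suc p))) ⟩
      suc (sumBelow M (λ p → bit (not (covers A p)))) ∎
      where open ≡-Reasoning

    rank-path : rank vs A ≡ coveredGaps A
    rank-path = begin
      length vs ∸ components vs A
        ≡⟨ cong₂ _∸_ length-vertices components-path ⟩
      M ∸ uncovered
        ≡⟨ cong (_∸ uncovered) (sym (sumBelow-not+sumBelow M (covers A))) ⟩
      uncovered + coveredGaps A ∸ uncovered
        ≡⟨ m+n∸m≡n uncovered (coveredGaps A) ⟩
      coveredGaps A ∎
      where
        open ≡-Reasoning
        uncovered : ℕ
        uncovered = sumBelow M (λ p → bit (not (covers A p)))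

module PathTutte {V : Set} (_≟_ : DecidableEquality V) {vs : List V} {M : ℕ}
                 (P : PathNumbering vs M) where
  open GraphTheory _≟_ using (tutte; rank; sublists)
  open GraphFacts _≟_ using (∈-sublists⁻)
  open PathGraph _≟_ P

  tutte-path : ∀ {r ℓ} (R : CommutativeRing r ℓ) (E : List (V × V)) →
    (∀ {e} → e ∈ E → IsLink e) → (∀ p → p < M → T (covers E p)) →
    ∀ x y → CommutativeRing._≈_ R (tutte R (mkGraph vs E) x y)
                                  (RingFacts.prodBelow R M (λ p → RingFacts.bundle R x y (mult E p)))
  tutte-path R E links covered x y = begin
    tutte R (mkGraph vs E) x y
      ≡⟨ sumOver-cong (sublists E) term≡ ⟩
    subsetSum E []
      ≈⟨ subsetSum-factorises E [] (All.tabulate (link-gap<M ∘ links)) [] ⟩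
    nullityTerm [] *ᴿ prodBelow M (factor E [])
      ≡⟨ cong (λ k → (y -ᴿ 1#) ^ᴿ k *ᴿ prodBelow M (factor E [])) (0∸n≡0 (coveredGaps [])) ⟩
    1# *ᴿ prodBelow M (factor E [])
      ≈⟨ *ᴿ-identityˡ _ ⟩
    prodBelow M (λ p → bundle x y (mult E p)) ∎
    where
      open CommutativeRing R using (1#)
        renaming (_*_ to _*ᴿ_; _-_ to _-ᴿ_; *-identityˡ to *ᴿ-identityˡ)
      open import Relation.Binary.Reasoning.Setoid (CommutativeRing.setoid R)
      open RingFacts R
      open SubsetSums R _≟_ gap M x y
      rank-sub : ∀ {A} → A ∈ sublists E → rank vs A ≡ coveredGaps A
      rank-sub A∈ = Blocks.rank-path _ (links ∘ ∈-sublists⁻ E A∈)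
      term≡ : ∀ {A} → A ∈ sublists E →
        (x -ᴿ 1#) ^ᴿ (rank vs E ∸ rank vs A) *ᴿ (y -ᴿ 1#) ^ᴿ (length A ∸ rank vs A) ≡ term (A ++ [])
      term≡ {A} A∈ = trans
        (cong₂ (λ h h′ → ((x -ᴿ 1#) ^ᴿ (h ∸ h′)) *ᴿ ((y -ᴿ 1#) ^ᴿ (length A ∸ h′)))
               (trans (Blocks.rank-path E links) (coveredGaps-all {E} covered)) (rank-sub A∈))
        (cong term (sym (++-identityʳ A)))

-- A reflected binary (Gray) code read from the last letter; it numbers the vertices of Γ_n^*
-- along the path.
posCons : Bool → ℕ → ℕ
posCons x q = bit (x xor isEven q) + double q

pos : ∀ {n} → Word n → ℕ
pos []      = 0
pos (x ∷ w) = posCons x (pos w)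

xor-cancelʳ : ∀ e {x y} → x xor e ≡ y xor e → x ≡ y
xor-cancelʳ e {false} {false} _  = refl
xor-cancelʳ e {true}  {true}  _  = refl
xor-cancelʳ e {false} {true}  eq = ⊥-elim (not-¬ refl eq)
xor-cancelʳ e {true}  {false} eq = ⊥-elim (not-¬ refl (sym eq))

xor-xor : ∀ x e → (x xor e) xor e ≡ x
xor-xor x e = trans (xor-assoc x e e) (trans (cong (x xor_) (xor-same e)) (xor-identityʳ x))

pos-injective : ∀ {n} {u v : Word n} → pos u ≡ pos v → u ≡ v
pos-injective {u = []}    {[]}    _  = refl
pos-injective {u = x ∷ u} {y ∷ v} eq with bit+double-injective eq
... | x≡y , pu≡pv with pos-injective {u = u} {v} pu≡pv
... | refl = cong (_∷ u) (xor-cancelʳ (isEven (pos u)) x≡y)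

pos<2^n : ∀ {n} (w : Word n) → pos w < 2 ^ n
pos<2^n []            = s≤s z≤n
pos<2^n {suc n} (x ∷ w) =
  subst (pos (x ∷ w) <_) (double≡2* (2 ^ n)) (bit+double<double _ (pos<2^n w))

wordAt : ∀ n {k} → k < 2 ^ n → Σ (Word n) λ w → pos w ≡ k
wordAt zero    {zero}  _       = [] , refl
wordAt zero    {suc k} (s≤s ())
wordAt (suc n) {k}     k<2^n with bit+double-surjective k
... | t , q , eq with wordAt n (bit+double<double⁻ t q (2 ^ n)
                       (subst₂ _<_ (sym eq) (sym (double≡2* (2 ^ n))) k<2^n))
... | w , refl = (t xor isEven (pos w)) ∷ w ,
                 trans (cong (λ β → bit β + double (pos w)) (xor-xor t (isEven (pos w)))) eq

length-allWords : ∀ n → length (allWords n) ≡ 2 ^ n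
length-allWords zero    = refl
length-allWords (suc n) = begin
  length (map (false ∷_) (allWords n) ++ map (true ∷_) (allWords n))
    ≡⟨ length-++ (map (false ∷_) (allWords n)) ⟩
  length (map (false ∷_) (allWords n)) + length (map (true ∷_) (allWords n))
    ≡⟨ cong₂ _+_ (length-map (false ∷_) (allWords n)) (length-map (true ∷_) (allWords n)) ⟩
  length (allWords n) + length (allWords n)
    ≡⟨ cong (λ k → k + k) (length-allWords n) ⟩
  2 ^ n + 2 ^ n
    ≡⟨ cong (2 ^ n +_) (sym (+-identityʳ (2 ^ n))) ⟩
  2 ^ suc n ∎
  where open ≡-Reasoning

∈-allWords : ∀ {n} (w : Word n) → w ∈ allWords n
∈-allWords []              = here refl
∈-allWords {suc n} (false ∷ w) = ∈-++⁺ˡ (∈-map⁺ (false ∷_) (∈-allWords w))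
∈-allWords {suc n} (true ∷ w)  = ∈-++⁺ʳ (map (false ∷_) (allWords n)) (∈-map⁺ (true ∷_) (∈-allWords w))

2^n≡1+[2^n∸1] : ∀ n → 2 ^ n ≡ suc (2 ^ n ∸ 1)
2^n≡1+[2^n∸1] n = sym (m+[n∸m]≡n (m^n>0 2 n))

2^[1+n]∸1≡1+2[2^n∸1] : ∀ n → 2 ^ suc n ∸ 1 ≡ suc (double (2 ^ n ∸ 1))
2^[1+n]∸1≡1+2[2^n∸1] n = cong (_∸ 1) (trans (sym (double≡2* (2 ^ n))) (cong double (2^n≡1+[2^n∸1] n)))


wordNumbering : ∀ n → PathNumbering (allWords n) (2 ^ n ∸ 1)
wordNumbering n = record
  { pos             = pos
  ; pos-injective   = pos-injective
  ; pos≤M           = λ w → ≤-pred (subst (pos w <_) (2^n≡1+[2^n∸1] n) (pos<2^n w))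
  ; vertexAt        = λ {k} k≤M → wordAt n (subst (k <_) (sym (2^n≡1+[2^n∸1] n)) (s≤s k≤M))
  ; ∈-vertices      = ∈-allWords
  ; length-vertices = trans (length-allWords n) (2^n≡1+[2^n∸1] n)
  }

data Consecutive (parity : Bool) : ℕ → ℕ → Set where
  forward  : ∀ {p} → isEven p ≡ parity → Consecutive parity p (suc p)
  backward : ∀ {p} → isEven p ≡ parity → Consecutive parity (suc p) p

consecutive-forward : ∀ {t p q} → Consecutive t p q → isEven p ≡ t → q ≡ suc p
consecutive-forward (forward _)        _  = refl
consecutive-forward (backward {p} e) e′ = ⊥-elim (not-¬ refl (sym (trans e′ (sym e))))

consecutive-parity : ∀ {t p} → Consecutive t p (suc p) → isEven p ≡ t
consecutive-parity (forward e) = e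

consecutive⇒link : ∀ {t p q} → Consecutive t p q → q ≡ suc p ⊎ p ≡ suc q
consecutive⇒link (forward _)  = inj₁ refl
consecutive⇒link (backward _) = inj₂ refl

consecutive-posCons-false : ∀ {q q′} → Consecutive true q q′ →
                            Consecutive false (posCons false q) (posCons false q′)
consecutive-posCons-false (forward  {q} e) rewrite e = forward  (cong not (isEven-double q))
consecutive-posCons-false (backward {q} e) rewrite e = backward (cong not (isEven-double q))

consecutive-posCons-true : ∀ {q q′} → Consecutive false q q′ →
                           Consecutive false (posCons true q) (posCons true q′)
consecutive-posCons-true (forward  {q} e) rewrite e = forward  (cong not (isEven-double q))
consecutive-posCons-true (backward {q} e) rewrite e = backward (cong not (isEven-double q))

actA-consecutive : ∀ {n} (w : Word (suc n)) → Consecutive true (pos w) (pos (actA w))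
actA-consecutive (x ∷ w) with isEven (pos w)
actA-consecutive (true  ∷ w) | true  = forward  (isEven-double (pos w))
actA-consecutive (false ∷ w) | true  = backward (isEven-double (pos w))
actA-consecutive (true  ∷ w) | false = backward (isEven-double (pos w))
actA-consecutive (false ∷ w) | false = forward  (isEven-double (pos w))

FixedOrOdd : ∀ {n} → Word n → Word n → Set
FixedOrOdd w v = v ≡ w ⊎ Consecutive false (pos w) (pos v)

fixedOrOdd-false∷ : ∀ {n} (w : Word n) → FixedOrOdd (false ∷ w) (false ∷ actA w)
fixedOrOdd-false∷ []      = inj₁ refl
fixedOrOdd-false∷ (y ∷ w) = inj₂ (consecutive-posCons-false (actA-consecutive (y ∷ w)))

fixedOrOdd-true∷ : ∀ {n} {w v : Word n} → FixedOrOdd w v → FixedOrOdd (true ∷ w) (true ∷ v)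
fixedOrOdd-true∷ (inj₁ refl) = inj₁ refl
fixedOrOdd-true∷ (inj₂ step) = inj₂ (consecutive-posCons-true step)

mutual
  actB-fixedOrOdd : ∀ {n} (w : Word n) → FixedOrOdd w (actB w)
  actB-fixedOrOdd []          = inj₁ refl
  actB-fixedOrOdd (false ∷ w) = fixedOrOdd-false∷ w
  actB-fixedOrOdd (true ∷ w)  = fixedOrOdd-true∷ (actC-fixedOrOdd w)

  actC-fixedOrOdd : ∀ {n} (w : Word n) → FixedOrOdd w (actC w)
  actC-fixedOrOdd []          = inj₁ refl
  actC-fixedOrOdd (false ∷ w) = fixedOrOdd-false∷ w
  actC-fixedOrOdd (true ∷ w)  = fixedOrOdd-true∷ (actD-fixedOrOdd w)

  actD-fixedOrOdd : ∀ {n} (w : Word n) → FixedOrOdd w (actD w)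
  actD-fixedOrOdd []          = inj₁ refl
  actD-fixedOrOdd (false ∷ w) = inj₁ refl
  actD-fixedOrOdd (true ∷ w)  = fixedOrOdd-true∷ (actB-fixedOrOdd w)

gapParity : Gen → Bool
gapParity a = true
gapParity b = false
gapParity c = false
gapParity d = false

act-consecutive : ∀ s {n} (u : Word n) → ¬ act s u ≡ u →
                  Consecutive (gapParity s) (pos u) (pos (act s u))
act-consecutive a []      moves = ⊥-elim (moves refl)
act-consecutive a (x ∷ u) moves = actA-consecutive (x ∷ u)
act-consecutive b u       moves = [ ⊥-elim ∘ moves , id ]′ (actB-fixedOrOdd u)
act-consecutive c u       moves = [ ⊥-elim ∘ moves , id ]′ (actC-fixedOrOdd u)
act-consecutive d u       moves = [ ⊥-elim ∘ moves , id ]′ (actD-fixedOrOdd u)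

mutual
  actA-involutive : ∀ {n} (w : Word n) → actA (actA w) ≡ w
  actA-involutive []      = refl
  actA-involutive (x ∷ w) = cong (_∷ w) (not-involutive x)

  actB-involutive : ∀ {n} (w : Word n) → actB (actB w) ≡ w
  actB-involutive []          = refl
  actB-involutive (false ∷ w) = cong (false ∷_) (actA-involutive w)
  actB-involutive (true ∷ w)  = cong (true ∷_) (actC-involutive w)

  actC-involutive : ∀ {n} (w : Word n) → actC (actC w) ≡ w
  actC-involutive []          = refl
  actC-involutive (false ∷ w) = cong (false ∷_) (actA-involutive w)
  actC-involutive (true ∷ w)  = cong (true ∷_) (actD-involutive w)

  actD-involutive : ∀ {n} (w : Word n) → actD (actD w) ≡ w
  actD-involutive []          = refl
  actD-involutive (false ∷ w) = refl
  actD-involutive (true ∷ w)  = cong (true ∷_) (actB-involutive w)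

act-involutive : ∀ s {n} (w : Word n) → act s (act s w) ≡ w
act-involutive a = actA-involutive
act-involutive b = actB-involutive
act-involutive c = actC-involutive
act-involutive d = actD-involutive

moves : Gen → ∀ {n} → Word n → Bool
moves s w = not ⌊ act s w ≟W w ⌋

≟W-∷ : ∀ {n} x (u v : Word n) → ⌊ (x ∷ u) ≟W (x ∷ v) ⌋ ≡ ⌊ u ≟W v ⌋
≟W-∷ x u v = trans (isYes≗does ((x ∷ u) ≟W (x ∷ v)))
  (trans (does-⇔ (mk⇔ ∷-injectiveʳ (cong (x ∷_))) ((x ∷ u) ≟W (x ∷ v)) (u ≟W v))
         (sym (isYes≗does (u ≟W v))))

≟W-≡ : ∀ {n} {u v : Word n} → u ≡ v → ⌊ u ≟W v ⌋ ≡ true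
≟W-≡ {u = u} {v} u≡v = trans (isYes≗does (u ≟W v)) (dec-true (u ≟W v) u≡v)

≟W-≢ : ∀ {n} {u v : Word n} → ¬ u ≡ v → ⌊ u ≟W v ⌋ ≡ false
≟W-≢ {u = u} {v} u≢v = trans (isYes≗does (u ≟W v)) (dec-false (u ≟W v) u≢v)

actA-moves : ∀ {n} (w : Word n) → 0 < n → ¬ actA w ≡ w
actA-moves (true ∷ w)  _ ()
actA-moves (false ∷ w) _ ()

-- On 0w the generators b, c, d act as a, a, 1, and on 1w as c, d, b on w: so at odd positions the
-- count is either 1 + 1 + 0 or inherited from w.
bcd-moves-odd : ∀ {n} (w : Word n) → isEven (pos w) ≡ false → suc (pos w) < 2 ^ n →
                bit (moves b w) + (bit (moves c w) + bit (moves d w)) ≡ 2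
bcd-moves-odd {suc n} (x ∷ w) odd last with isEven (pos w) in even?
bcd-moves-odd (true ∷ w)          odd _ | true = ⊥-elim (not-¬ (isEven-double (pos w)) odd)
bcd-moves-odd (false ∷ [])        _ (s≤s (s≤s ())) | true
bcd-moves-odd (false ∷ y ∷ w)     _ _ | true
  rewrite ≟W-∷ false (actA (y ∷ w)) (y ∷ w)
        | ≟W-≢ (actA-moves (y ∷ w) z<s)
        | ≟W-≡ (refl {x = false ∷ y ∷ w}) = refl
bcd-moves-odd (false ∷ w)         odd _ | false = ⊥-elim (not-¬ (isEven-double (pos w)) odd)
bcd-moves-odd {suc n} (true ∷ w)  _ last | false
  rewrite ≟W-∷ true (actC w) w | ≟W-∷ true (actD w) w | ≟W-∷ true (actB w) w =
  trans (rotate (bit (moves c w)) (bit (moves d w)) (bit (moves b w)))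
        (bcd-moves-odd w even? (double-cancel-< (suc (pos w)) (2 ^ n)
                                  (subst (double (suc (pos w)) <_) (sym (double≡2* (2 ^ n))) last)))
  where
    rotate : ∀ i j k → i + (j + k) ≡ k + (i + j)
    rotate i j k = trans (sym (+-assoc i j k)) (+-comm (i + j) k)

sumList-allWords-suc : ∀ {n} (f : Word (suc n) → ℕ) → sumList f (allWords (suc n)) ≡
  sumList (λ u → f (false ∷ u)) (allWords n) + sumList (λ u → f (true ∷ u)) (allWords n)
sumList-allWords-suc {n} f =
  trans (sumList-++ f (map (false ∷_) (allWords n)) _)
        (cong₂ _+_ (sumList-map f (false ∷_) (allWords n)) (sumList-map f (true ∷_) (allWords n)))

pointMass : ∀ {n} → Word n → ℕ → Word n → ℕ
pointMass w k u = if ⌊ u ≟W w ⌋ then k else 0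

sumList-pointMass-∷ : ∀ {n} x (w : Word n) k →
  sumList (λ u → pointMass (x ∷ w) k (x ∷ u)) (allWords n) ≡ sumList (pointMass w k) (allWords n)
sumList-pointMass-∷ {n} x w k =
  sumList-cong (allWords n) (λ u → cong (λ β → if β then k else 0) (≟W-∷ x u w))

sumList-pointMass-other : ∀ {n} {z x} → ¬ z ≡ x → (w : Word n) → ∀ k →
  sumList (λ u → pointMass (x ∷ w) k (z ∷ u)) (allWords n) ≡ 0
sumList-pointMass-other {n} z≢x w k =
  trans (sumList-cong (allWords n) (λ u → cong (λ β → if β then k else 0) (≟W-≢ (z≢x ∘ ∷-injectiveˡ))))
        (sumList-zero (allWords n))

sumList-pointMass : ∀ {n} (w : Word n) k → sumList (pointMass w k) (allWords n) ≡ k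
sumList-pointMass []                k = +-identityʳ k
sumList-pointMass {suc n} (false ∷ w) k =
  trans (sumList-allWords-suc (pointMass (false ∷ w) k))
        (trans (cong₂ _+_ (trans (sumList-pointMass-∷ false w k) (sumList-pointMass w k))
                          (sumList-pointMass-other {z = true} {false} (λ ()) w k))
               (+-identityʳ k))
sumList-pointMass {suc n} (true ∷ w)  k =
  trans (sumList-allWords-suc (pointMass (true ∷ w) k))
        (cong₂ _+_ (sumList-pointMass-other {z = false} {true} (λ ()) w k)
                   (trans (sumList-pointMass-∷ true w k) (sumList-pointMass w k)))

sumList-allWords-pair : ∀ {n} (f : Word n → ℕ) {w₁ w₂} → ¬ w₁ ≡ w₂ →
  (∀ u → ¬ f u ≡ 0 → u ≡ w₁ ⊎ u ≡ w₂) → sumList f (allWords n) ≡ f w₁ + f w₂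
sumList-allWords-pair {n} f {w₁} {w₂} w₁≢w₂ support = begin
  sumList f (allWords n)
    ≡⟨ sumList-cong (allWords n) split ⟩
  sumList (λ u → pointMass w₁ (f w₁) u + pointMass w₂ (f w₂) u) (allWords n)
    ≡⟨ sumList-+ (pointMass w₁ (f w₁)) (pointMass w₂ (f w₂)) (allWords n) ⟩
  sumList (pointMass w₁ (f w₁)) (allWords n) + sumList (pointMass w₂ (f w₂)) (allWords n)
    ≡⟨ cong₂ _+_ (sumList-pointMass w₁ (f w₁)) (sumList-pointMass w₂ (f w₂)) ⟩
  f w₁ + f w₂ ∎
  where
    open ≡-Reasoning
    split : ∀ u → f u ≡ pointMass w₁ (f w₁) u + pointMass w₂ (f w₂) u
    split u with u ≟W w₁ | u ≟W w₂
    ... | yes refl | yes u≡w₂ = ⊥-elim (w₁≢w₂ u≡w₂)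
    ... | yes refl | no  _    = sym (+-identityʳ (f u))
    ... | no  _    | yes refl = refl
    ... | no  u≢w₁ | no  u≢w₂ with f u ≟ 0
    ...   | yes fu≡0 = fu≡0
    ...   | no  fu≢0 = ⊥-elim ([ u≢w₁ , u≢w₂ ]′ (support u fu≢0))

-- The edges of Γ_n^* at each gap

lexLess-antisym : ∀ {n} {u v : Word n} → ¬ u ≡ v → lexLess u v ≡ not (lexLess v u)
lexLess-antisym {u = []}        {[]}        u≢v = ⊥-elim (u≢v refl)
lexLess-antisym {u = false ∷ u} {false ∷ v} u≢v = lexLess-antisym (u≢v ∘ cong (false ∷_))
lexLess-antisym {u = true ∷ u}  {true ∷ v}  u≢v = lexLess-antisym (u≢v ∘ cong (true ∷_))
lexLess-antisym {u = false ∷ u} {true ∷ v}  _   = refl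
lexLess-antisym {u = true ∷ u}  {false ∷ v} _   = refl

-- The local edgeAt of orbitEdges, restated because a where-bound function cannot be named.
orbitEdge : ∀ {n} → Gen → Word n → List (Word n × Word n)
orbitEdge s u = if ⌊ act s u ≟W u ⌋ then (u , u) ∷ []
                else (if lexLess u (act s u) then (u , act s u) ∷ [] else [])

nonLoop? : ∀ {n} → Decidable (λ (e : Word n × Word n) → ¬ proj₁ e ≡ proj₂ e)
nonLoop? e = ¬? (proj₁ e ≟W proj₂ e)

orbitEdge-nonLoop : ∀ s {n} (u : Word n) {e} → e ∈ orbitEdge s u → ¬ proj₁ e ≡ proj₂ e →
                    e ≡ (u , act s u) × ¬ act s u ≡ u
orbitEdge-nonLoop s u e∈ nonLoop with act s u ≟W u
orbitEdge-nonLoop s u (here refl) nonLoop | yes _ = ⊥-elim (nonLoop refl)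
orbitEdge-nonLoop s u e∈          nonLoop | no moved with lexLess u (act s u)
orbitEdge-nonLoop s u (here refl) nonLoop | no moved | true = refl , moved

Γ*-edge : ∀ {n e} → e ∈ edges (Γ* n) →
          Σ Gen λ s → Σ (Word n) λ u → e ≡ (u , act s u) × ¬ act s u ≡ u
Γ*-edge {n} e∈ with ∈-filter⁻ nonLoop? {xs = concatMap (orbitEdges n) generators} e∈
... | e∈Γ , nonLoop with find (∈-concatMap⁻ (orbitEdges n) {xs = generators} e∈Γ)
...   | s , _ , e∈s with find (∈-concatMap⁻ (orbitEdge s) {xs = allWords n} e∈s)
...     | u , _ , e∈u = s , u , orbitEdge-nonLoop s u e∈u nonLoop

p<2^n∸1⇒0<n : ∀ {n p} → p < 2 ^ n ∸ 1 → 0 < n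
p<2^n∸1⇒0<n {suc n} _ = z<s

module Γ*-Gaps (n : ℕ) where
  open PathGraph (_≟W_ {n}) (wordNumbering n)

  Γ*-link : ∀ {e} → e ∈ edges (Γ* n) → IsLink e
  Γ*-link e∈ with Γ*-edge e∈
  ... | s , u , refl , moved = consecutive⇒link (act-consecutive s u moved)

  module AtGap {p} (p<M : p < 2 ^ n ∸ 1) where
    p+1<2^n : suc p < 2 ^ n
    p+1<2^n = subst (suc p <_) (sym (2^n≡1+[2^n∸1] n)) (s≤s p<M)

    w₁ w₂ : Word n
    w₁ = proj₁ (wordAt n (<-trans (n<1+n p) p+1<2^n))
    w₂ = proj₁ (wordAt n p+1<2^n)

    pw₁ : pos w₁ ≡ p
    pw₁ = proj₂ (wordAt n (<-trans (n<1+n p) p+1<2^n))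

    pw₂ : pos w₂ ≡ suc p
    pw₂ = proj₂ (wordAt n p+1<2^n)

    w₁≢w₂ : ¬ w₁ ≡ w₂
    w₁≢w₂ eq = <⇒≢ (n<1+n p) (trans (sym pw₁) (trans (cong pos eq) pw₂))

    contribution : Gen → Word n → ℕ
    contribution s u = mult (filter nonLoop? (orbitEdge s u)) p

    contribution-support : ∀ s u → ¬ contribution s u ≡ 0 →
      (u ≡ w₁ × act s u ≡ w₂) ⊎ (u ≡ w₂ × act s u ≡ w₁)
    contribution-support s u nz with mult≢0⇒gap (filter nonLoop? (orbitEdge s u)) nz
    ... | e , e∈ , gap≡p with ∈-filter⁻ nonLoop? {xs = orbitEdge s u} e∈
    ...   | e∈u , nonLoop with orbitEdge-nonLoop s u e∈u nonLoop
    ...     | refl , moved with link-ends {u , act s u} (consecutive⇒link (act-consecutive s u moved))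
    ...       | inj₁ (p₁ , p₂) = inj₁ (pos-injective (trans p₁ (trans gap≡p (sym pw₁))) ,
                                       pos-injective (trans p₂ (trans (cong suc gap≡p) (sym pw₂))))
    ...       | inj₂ (p₁ , p₂) = inj₂ (pos-injective (trans p₁ (trans (cong suc gap≡p) (sym pw₂))) ,
                                       pos-injective (trans p₂ (trans gap≡p (sym pw₁))))

    contribution-edge : ∀ s {u v} → act s u ≡ v → ¬ u ≡ v → gap (u , v) ≡ p →
                        contribution s u ≡ bit (lexLess u v)
    contribution-edge s {u} refl u≢v gap≡p with act s u ≟W u
    ... | yes fixed = ⊥-elim (u≢v (sym fixed))
    ... | no _ with lexLess u (act s u)
    ...   | false = refl
    ...   | true  = trans (cong (λ l → mult l p) (filter-accept nonLoop? {xs = []} u≢v))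
                          (cong (λ β → bit β + 0) (≡⇒≡ᵇ-true gap≡p))

    -- The orbit {w₁, w₂} of s, when it exists, yields exactly one edge (from its lex-smaller end).
    contribution-pair : ∀ s → contribution s w₁ + contribution s w₂ ≡ bit ⌊ act s w₁ ≟W w₂ ⌋
    contribution-pair s with act s w₁ ≟W w₂
    ... | yes s₁≡₂ =
      trans (cong₂ _+_ (contribution-edge s s₁≡₂ w₁≢w₂ gap₁₂) (contribution-edge s s₂≡₁ (w₁≢w₂ ∘ sym) gap₂₁))
            (trans (cong (λ β → bit (lexLess w₁ w₂) + bit β) (lexLess-antisym (w₁≢w₂ ∘ sym)))
                   (trans (+-comm (bit (lexLess w₁ w₂)) _) (bit-not+bit≡1 (lexLess w₁ w₂))))
      where
        s₂≡₁ : act s w₂ ≡ w₁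
        s₂≡₁ = trans (cong (act s) (sym s₁≡₂)) (act-involutive s w₁)
        gap₁₂ : gap (w₁ , w₂) ≡ p
        gap₁₂ = trans (cong₂ _⊓_ pw₁ pw₂) (m≤n⇒m⊓n≡m (n≤1+n p))
        gap₂₁ : gap (w₂ , w₁) ≡ p
        gap₂₁ = trans (cong₂ _⊓_ pw₂ pw₁) (m≥n⇒m⊓n≡n (n≤1+n p))
    ... | no s₁≢₂ =
      cong₂ _+_ (vanishes w₁ (λ _ → s₁≢₂) (λ w₁≡w₂ _ → w₁≢w₂ w₁≡w₂))
                (vanishes w₂ (λ w₂≡w₁ _ → w₁≢w₂ (sym w₂≡w₁))
                             (λ _ s₂≡₁ → s₁≢₂ (trans (cong (act s) (sym s₂≡₁)) (act-involutive s w₂))))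
      where
        vanishes : ∀ u → (u ≡ w₁ → ¬ act s u ≡ w₂) → (u ≡ w₂ → ¬ act s u ≡ w₁) → contribution s u ≡ 0
        vanishes u h₁ h₂ with contribution s u ≟ 0
        ... | yes z  = z
        ... | no  nz with contribution-support s u nz
        ...   | inj₁ (u≡ , su≡) = ⊥-elim (h₁ u≡ su≡)
        ...   | inj₂ (u≡ , su≡) = ⊥-elim (h₂ u≡ su≡)

    mult-jumps : mult (edges (Γ* n)) p ≡ sumList (λ s → bit ⌊ act s w₁ ≟W w₂ ⌋) generators
    mult-jumps = begin
      mult (edges (Γ* n)) p
        ≡⟨ sumList-filter-concatMap nonLoop? (λ e → bit (gap e ≡ᵇ p)) (orbitEdges n) generators ⟩
      sumList (λ s → mult (filter nonLoop? (orbitEdges n s)) p) generators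
        ≡⟨ sumList-cong generators (λ s →
             sumList-filter-concatMap nonLoop? (λ e → bit (gap e ≡ᵇ p)) (orbitEdge s) (allWords n)) ⟩
      sumList (λ s → sumList (contribution s) (allWords n)) generators
        ≡⟨ sumList-cong generators (λ s → trans (sumList-allWords-pair (contribution s) w₁≢w₂ (support s))
                                               (contribution-pair s)) ⟩
      sumList (λ s → bit ⌊ act s w₁ ≟W w₂ ⌋) generators ∎
      where
        open ≡-Reasoning
        support : ∀ s u → ¬ contribution s u ≡ 0 → u ≡ w₁ ⊎ u ≡ w₂
        support s u nz = Sum.map proj₁ proj₁ (contribution-support s u nz)

    jumps : Gen → Bool
    jumps s = ⌊ act s w₁ ≟W w₂ ⌋

    jumps-wrong-parity : ∀ s → ¬ gapParity s ≡ isEven p → jumps s ≡ false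
    jumps-wrong-parity s wrong = ≟W-≢ λ s₁≡₂ → wrong (sym (consecutive-parity
      (subst₂ (Consecutive (gapParity s)) pw₁ (trans (cong pos s₁≡₂) pw₂)
              (act-consecutive s w₁ (λ fixed → w₁≢w₂ (trans (sym fixed) s₁≡₂))))))

    jumps-right-parity : ∀ s → gapParity s ≡ isEven p → jumps s ≡ moves s w₁
    jumps-right-parity s right with act s w₁ ≟W w₁
    ... | yes fixed = ≟W-≢ (λ s₁≡₂ → w₁≢w₂ (trans (sym fixed) s₁≡₂))
    ... | no  moved = ≟W-≡ (pos-injective
      (trans (consecutive-forward (act-consecutive s w₁ moved) (trans (cong isEven pw₁) (sym right)))
             (trans (cong suc pw₁) (sym pw₂))))

    mult-even : isEven p ≡ true → mult (edges (Γ* n)) p ≡ 1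
    mult-even even = trans mult-jumps count
      where
        odd-gap : ∀ s → gapParity s ≡ false → ¬ gapParity s ≡ isEven p
        odd-gap s false≡ eq = contradiction (trans (sym false≡) (trans eq even)) λ ()
        count : bit (jumps a) + (bit (jumps b) + (bit (jumps c) + (bit (jumps d) + 0))) ≡ 1
        count rewrite jumps-right-parity a (sym even)
                    | ≟W-≢ (actA-moves w₁ (p<2^n∸1⇒0<n p<M))
                    | jumps-wrong-parity b (odd-gap b refl)
                    | jumps-wrong-parity c (odd-gap c refl)
                    | jumps-wrong-parity d (odd-gap d refl) = refl

    mult-odd : isEven p ≡ false → mult (edges (Γ* n)) p ≡ 2
    mult-odd odd = trans mult-jumps count
      where
        count : bit (jumps a) + (bit (jumps b) + (bit (jumps c) + (bit (jumps d) + 0))) ≡ 2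
        count rewrite jumps-wrong-parity a (λ eq → contradiction (trans eq odd) λ ())
                    | jumps-right-parity b (sym odd)
                    | jumps-right-parity c (sym odd)
                    | jumps-right-parity d (sym odd)
                    | +-identityʳ (bit (moves d w₁)) =
          bcd-moves-odd w₁ (trans (cong isEven pw₁) odd) (subst (λ k → suc k < 2 ^ n) (sym pw₁) p+1<2^n)

  mult-Γ*≢0 : ∀ {p} → p < 2 ^ n ∸ 1 → ¬ mult (edges (Γ* n)) p ≡ 0
  mult-Γ*≢0 {p} p<M with isEven p in parity
  ... | true  = λ m≡0 → contradiction (trans (sym m≡0) (AtGap.mult-even p<M parity)) λ ()
  ... | false = λ m≡0 → contradiction (trans (sym m≡0) (AtGap.mult-odd p<M parity)) λ ()

  Γ*-covers : ∀ p → p < 2 ^ n ∸ 1 → T (covers (edges (Γ* n)) p)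
  Γ*-covers p p<M =
    let e , e∈ , gap≡p = mult≢0⇒gap (edges (Γ* n)) (mult-Γ*≢0 p<M) in gap⇒covers e∈ gap≡p

  bundle-Γ* : ∀ {r ℓ} (R : CommutativeRing r ℓ) x y {p} → p < 2 ^ n ∸ 1 →
    CommutativeRing._≈_ R (RingFacts.bundle R x y (mult (edges (Γ* n)) p))
                          (if isEven p then x else CommutativeRing._+_ R y x)
  bundle-Γ* R x y {p} p<M = by-parity (isEven p) refl
    where
      open CommutativeRing R using (_≈_)
        renaming (_+_ to _+ᴿ_; trans to ≈-trans; reflexive to ≈-reflexive)
      open RingFacts R using (bundle; bundle-1; bundle-2)
      by-parity : ∀ β → isEven p ≡ β → bundle x y (mult (edges (Γ* n)) p) ≈ (if β then x else y +ᴿ x)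
      by-parity true  even = ≈-trans (≈-reflexive (cong (bundle x y) (AtGap.mult-even p<M even))) (bundle-1 x y)
      by-parity false odd  = ≈-trans (≈-reflexive (cong (bundle x y) (AtGap.mult-odd p<M odd))) (bundle-2 x y)
mainTheorem17 : ∀ {c ℓ} (R : CommutativeRing c ℓ) (n : ℕ) → n ≥ 1 →
    ∀ (x y : CommutativeRing.Carrier R) →
    CommutativeRing._≈_ R (TutteW R n (Γ* n) x y)
      (CommutativeRing._*_ R
        (pow R x (2 ^ (n ∸ 1)))
        (pow R (CommutativeRing._+_ R y x) (2 ^ (n ∸ 1) ∸ 1)))
mainTheorem17 R (suc n) _ x y = begin
  TutteW R (suc n) (Γ* (suc n)) x y
    ≈⟨ tutte-path R (edges (Γ* (suc n))) Γ*-link Γ*-covers x y ⟩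
  prodBelow M (λ p → bundle x y (mult (edges (Γ* (suc n))) p))
    ≈⟨ prodBelow-cong M (λ p → bundle-Γ* R x y) ⟩
  prodBelow M alternating
    ≡⟨ cong (λ k → prodBelow k alternating) (2^[1+n]∸1≡1+2[2^n∸1] n) ⟩
  prodBelow (suc (double m)) alternating
    ≈⟨ prodBelow-alternating m x (y +ᴿ x) ⟩
  x ^ᴿ suc m *ᴿ (y +ᴿ x) ^ᴿ m
    ≡⟨ cong (λ k → x ^ᴿ k *ᴿ (y +ᴿ x) ^ᴿ (k ∸ 1)) (sym (2^n≡1+[2^n∸1] n)) ⟩
  x ^ᴿ (2 ^ n) *ᴿ (y +ᴿ x) ^ᴿ (2 ^ n ∸ 1) ∎
  where
    open CommutativeRing R using () renaming (_+_ to _+ᴿ_; _*_ to _*ᴿ_)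
    open import Relation.Binary.Reasoning.Setoid (CommutativeRing.setoid R)
    open RingFacts R
    open PathTutte (_≟W_ {suc n}) (wordNumbering (suc n))
    open PathGraph (_≟W_ {suc n}) (wordNumbering (suc n)) using (mult)
    open Γ*-Gaps (suc n)
    M m : ℕ
    M = 2 ^ suc n ∸ 1
    m = 2 ^ n ∸ 1
    alternating : ℕ → CommutativeRing.Carrier R
    alternating p = if isEven p then x else y +ᴿ x
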